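{- Let $l\ge2$ and let $\lambda$ be a partition. Then $(\lambda,0)$ is a $0$-core abacus of type $C_l^{(1)}$ if and only if $\lambda$ is a self-conjugate $2l$-core (a self-conjugate $0$-core of type $A_{2l-1}^{(1)}$).
   Context: The charge-$0$ abacus of $\lambda$ is $\beta_0(\lambda)=\{\lambda_i-i:i\ge1\}\subseteq\mathbb{Z}$. A $2l$-core is a partition with no hook length divisible by $2l$. For $0\le i\le l$, let $s_i$ be the operator on subsets $S\subseteq\mathbb{Z}$ that, for every $x\in\mathbb{Z}$ with $x+1\equiv \pm i\pmod{2l}$, exchanges the membership of $x$ and $x+1$ in $S$, and leaves other positions unchanged. These are the simple reflections of the affine Weyl group of type $C_l^{(1)}$ acting on abaci. $(\lambda,0)$ is a $0$-core abacus of type $C_l^{(1)}$ if $\beta_0(\lambda)$ lies in the orbit of $\mathbb{Z}_{<0}$ under the group generated by $s_0,\dots,s_l$. -}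

module Defs where

open import Data.Nat as ℕ using (ℕ; zero; suc; _≤_; _≤?_)
import Data.Nat.Divisibility as ℕD
open import Data.Integer as ℤ using (ℤ; +_; _-_; _<_)
import Data.Integer.Divisibility as ℤD
open import Data.List using (List; []; _∷_; length; filter; foldr)
open import Data.List.Relation.Unary.Linked using (Linked)
open import Data.Fin using (Fin; toℕ)
open import Data.Product using (Σ; ∃-syntax; _×_)
open import Data.Sum using (_⊎_)
open import Relation.Nullary using (¬_)
open import Relation.Binary.PropositionalEquality using (_≡_)

-- A partition: a weakly decreasing list of natural numbers
-- (trailing zero parts are harmless).
record Partition : Set where
  constructor mkPartition
  field
    parts      : List ℕ
    decreasing : Linked ℕ._≥_ parts
open Partition public

-- i-th part (1-based); λ_i = 0 beyond the list.
nth : List ℕ → ℕ → ℕ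
nth []       _             = 0
nth (x ∷ xs) zero          = 0
nth (x ∷ xs) (suc zero)    = x
nth (x ∷ xs) (suc (suc i)) = nth xs (suc i)

part : Partition → ℕ → ℕ
part p i = nth (parts p) i

conjPart : Partition → ℕ → ℕ
conjPart p j = length (filter (j ≤?_) (parts p))

SelfConjugate : Partition → Set
SelfConjugate p = ∀ j → 1 ≤ j → part p j ≡ conjPart p j

hook : Partition → ℕ → ℕ → ℕ
hook p i j = (part p i ℕ.∸ j) ℕ.+ (conjPart p j ℕ.∸ i) ℕ.+ 1

IsCore : ℕ → Partition → Set
IsCore e p = ∀ i j → 1 ≤ i → 1 ≤ j → j ≤ part p i → ¬ (e ℕD.∣ hook p i j)

Subset : Set₁
Subset = ℤ → Set

beta0 : Partition → Subset
beta0 p x = ∃[ i ] (1 ≤ i × x ≡ (+ part p i) - (+ i))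

negatives : Subset
negatives x = x < + 0

Cond : ℕ → ℕ → ℤ → Set
Cond l i z = ((+ (2 ℕ.* l)) ℤD.∣ (z - + i)) ⊎ ((+ (2 ℕ.* l)) ℤD.∣ (z ℤ.+ + i))

-- s_i: for every x with x+1 ≡ ±i (mod 2l), swap membership of x and x+1.
-- Position y receives S(y-1) if y ≡ ±i, S(y+1) if y+1 ≡ ±i, else S y.
sOp : (l i : ℕ) → Subset → Subset
sOp l i S y =
    (Cond l i y × S (y - + 1))
  ⊎ ((¬ Cond l i y) × Cond l i (y ℤ.+ + 1) × S (y ℤ.+ + 1))
  ⊎ ((¬ Cond l i y) × (¬ Cond l i (y ℤ.+ + 1)) × S y)

applyWord : (l : ℕ) → List (Fin (suc l)) → Subset → Subset
applyWord l w S = foldr (λ i T → sOp l (toℕ i) T) S w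

-- (λ,0) is a 0-core abacus of type C_l^(1): β₀(λ) lies in the orbit of ℤ_{<0}
-- under the group generated by s_0..s_l (each s_i is an involution, so words suffice)
IsCAbacusCore : ℕ → Partition → Set
IsCAbacusCore l p =
  ∃[ w ] (∀ x → (beta0 p x → applyWord l w negatives x) × (applyWord l w negatives x → beta0 p x))

module Submission where

open import Defs

-- Write S = β₀(λ).  Since β₀(λ′) = {-1-x : x ∉ S}, λ is self-conjugate iff S is
-- self-dual (x ∈ S ⇔ -1-x ∉ S); since the hooks of λ join the beads x ∈ S to the
-- holes below them, λ is a 2l-core iff S is closed under x ↦ x - 2l.  Both
-- properties hold for ℤ<0 and are preserved by every s_i, which is one direction.
-- Conversely, such an S is given by runner heights A (r + 2l·q ∈ S iff q < A r), on
-- which each s_i acts by exchanging neighbouring runners.  The size of the core is a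
-- nonnegative quadratic form in the heights, and unless all heights vanish, i.e.
-- S = ℤ<0, some s_i strictly decreases it; so S lies in the orbit of ℤ<0.

module SelfConjugateCores where

  open import Data.Nat as ℕ using (ℕ; zero; suc; z≤n; s≤s)
  import Data.Nat.Properties as ℕP
  import Data.Nat.Divisibility as ℕD
  import Data.Nat.Tactic.RingSolver as ℕ-Solver
  open import Data.Nat.Induction using (<-rec)
  open import Data.Integer as ℤ using (ℤ; +_; _+_; _-_; _*_; -_; _≤_; _<_; 0ℤ; 1ℤ; +≤+; +<+)
  import Data.Integer.Properties as ℤP
  open import Data.Integer.Properties using (i<j⇒suc[i]≤j; suc[i]≤j⇒i<j)
  import Data.Integer.Divisibility.Signed as ℤD
  open import Data.Integer.DivMod using (_/ℕ_; _%ℕ_; n%ℕd<d; a≡a%ℕn+[a/ℕn]*n)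
  open import Data.Integer.Tactic.RingSolver using (solve-∀)
  open import Data.List using (List; []; _∷_; length; filter)
  import Data.List.Properties as ListP
  open import Data.List.Relation.Unary.Linked as Linked using (Linked; []; [-]; _∷_)
  open import Data.Fin using (Fin; toℕ; fromℕ<)
  import Data.Fin.Properties as FinP
  open import Data.Product using (∃-syntax; _×_; _,_; proj₁; proj₂)
  import Data.Product as Product
  open import Data.Product.Function.NonDependent.Propositional using (_×-⇔_)
  open import Data.Sum using (_⊎_; inj₁; inj₂)
  import Data.Sum as Sum
  open import Data.Empty using (⊥; ⊥-elim)
  open import Function using (_∘_; _∘′_)
  open import Function.Bundles using (_⇔_; mk⇔; Equivalence)
  open import Function.Construct.Symmetry using (⇔-sym)
  open import Function.Properties.Equivalence using (⇔-setoid) renaming (refl to ⇔-refl; trans to ⇔-trans)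
  open import Function.Related.TypeIsomorphisms using (¬-cong-⇔)
  open import Level using (0ℓ)
  open import Relation.Binary.Definitions using (tri<; tri≈; tri>)
  open import Relation.Binary.PropositionalEquality
  import Relation.Binary.Reasoning.Setoid
  open import Relation.Nullary using (¬_; Dec; yes; no)
  import Relation.Nullary.Decidable as Dec
  open import Relation.Nullary.Decidable using (decidable-stable)

  open Equivalence

  module ⇔-Reasoning = Relation.Binary.Reasoning.Setoid (⇔-setoid 0ℓ)

  infixl 6 _⊕_
  _⊕_ : ∀ {a b c d} → a ≤ b → c ≤ d → a + c ≤ b + d
  _⊕_ = ℤP.+-mono-≤

  0≤+ : ∀ n → 0ℤ ≤ + n
  0≤+ n = +≤+ z≤n

  -- Linear arithmetic by hand: add up known inequalities c ≤ d with _⊕_ and let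
  -- the ring solver check that the gap d - c is the wanted gap b - a.
  ≤-by-gap : ∀ {a b c d} → c ≤ d → b - a ≡ d - c → a ≤ b
  ≤-by-gap c≤d eq = ℤP.0≤i-j⇒j≤i (subst (0ℤ ≤_) (sym eq) (ℤP.i≤j⇒0≤j-i c≤d))

  absurd-by-gap : ∀ {c d} → c ≤ d → 0ℤ - + 1 ≡ d - c → ⊥
  absurd-by-gap c≤d eq with ≤-by-gap {+ 1} {0ℤ} c≤d eq
  ... | +≤+ ()

  <-by-gap⇔ : ∀ {a b c d} → b - a ≡ d - c → (a < b) ⇔ (c < d)
  <-by-gap⇔ eq = mk⇔ (transfer eq) (transfer (sym eq))
    where
    transfer : ∀ {a b c d} → b - a ≡ d - c → a < b → c < d
    transfer {a} {b} {c} {d} eq a<b =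
      suc[i]≤j⇒i<j (≤-by-gap (i<j⇒suc[i]≤j a<b) (trans (gap d c) (trans (cong (_- 1ℤ) (sym eq)) (sym (gap b a)))))
      where
      gap : ∀ x y → x - (1ℤ + y) ≡ (x - y) - 1ℤ
      gap = solve-∀

  ¬[-q-1<a]⇔q<-a : ∀ {q a} → (¬ (- q - 1ℤ < a)) ⇔ (q < - a)
  ¬[-q-1<a]⇔q<-a {q} {a} =
    mk⇔ (λ ≮ → suc[i]≤j⇒i<j (≤-by-gap (ℤP.≮⇒≥ ≮) (gap₁ q a)))
        (λ q<-a → ℤP.≤⇒≯ (≤-by-gap (i<j⇒suc[i]≤j q<-a) (gap₂ q a)))
    where
    gap₁ : ∀ q a → - a - (1ℤ + q) ≡ (- q - 1ℤ) - a
    gap₁ = solve-∀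
    gap₂ : ∀ q a → (- q - 1ℤ) - a ≡ - a - (1ℤ + q)
    gap₂ = solve-∀

  ≡-by-thresholds : ∀ {a b} → (∀ q → (q < a) ⇔ (q < b)) → a ≡ b
  ≡-by-thresholds same = ℤP.≤-antisym (≤-by-thresholds (λ q → to (same q))) (≤-by-thresholds (λ q → from (same q)))
    where
    ≤-by-thresholds : ∀ {a b} → (∀ q → q < a → q < b) → a ≤ b
    ≤-by-thresholds {a} {b} below = ≤-by-gap (i<j⇒suc[i]≤j (below (a - 1ℤ) a-1<a)) (gap a b)
      where
      a-1<a : a - 1ℤ < a
      a-1<a = suc[i]≤j⇒i<j (ℤP.≤-reflexive (gap′ a))
        where
        gap′ : ∀ a → 1ℤ + (a - 1ℤ) ≡ a
        gap′ = solve-∀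
      gap : ∀ a b → b - a ≡ b - (1ℤ + (a - 1ℤ))
      gap = solve-∀

  ∣∣-mono-< : ∀ {a b} → 0ℤ ≤ a → a < b → ℤ.∣ a ∣ ℕ.< ℤ.∣ b ∣
  ∣∣-mono-< {a} {b} 0≤a a<b = ℤP.drop‿+<+ (subst₂ _<_ (sym (ℤP.0≤i⇒+∣i∣≡i 0≤a))
                                                    (sym (ℤP.0≤i⇒+∣i∣≡i (ℤP.≤-trans 0≤a (ℤP.<⇒≤ a<b)))) a<b)

  +∸ : ∀ {m k} → k ℕ.≤ m → + (m ℕ.∸ k) ≡ + m - + k
  +∸ {m} {k} k≤m = trans (sym (ℤP.⊖-≥ k≤m)) (sym (ℤP.m-n≡m⊖n m k))

  ∣-below⇒≡0 : ∀ {d n} → d ℕD.∣ n → n ℕ.< d → n ≡ 0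
  ∣-below⇒≡0 {n = zero}  _   _   = refl
  ∣-below⇒≡0 {n = suc n} d∣n n<d = ⊥-elim (ℕP.<⇒≱ n<d (ℕD.∣⇒≤ d∣n))

  start-of-run : (Q : ℕ → Set) → (∀ m → Dec (Q m)) → ∀ N → Q N →
                 ∃[ m ] (Q m × (∀ m′ → suc m′ ≡ m → ¬ Q m′))
  start-of-run Q Q? zero    q = 0 , q , λ _ ()
  start-of-run Q Q? (suc N) q with Q? N
  ... | yes qN = start-of-run Q Q? N qN
  ... | no ¬qN = suc N , q , λ { _ refl → ¬qN }

  run-length : ∀ {P : ℕ → Set} → (∀ n → Dec (P n)) → ℕ → ℕ
  run-length P? zero    = zero
  run-length P? (suc M) with P? 0
  ... | yes _ = suc (run-length (λ n → P? (suc n)) M)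
  ... | no _  = zero

  run-length-spec : ∀ {P : ℕ → Set} (P? : ∀ n → Dec (P n)) → (∀ n → P (suc n) → P n) →
                    ∀ M → ¬ P M → ∀ n → P n ⇔ (n ℕ.< run-length P? M)
  run-length-spec {P} P? P↓ zero ¬P0 n = mk⇔ (λ Pn → ⊥-elim (¬P0 (reaches-0 n Pn))) (λ ())
    where
    reaches-0 : ∀ n → P n → P 0
    reaches-0 zero    P0    = P0
    reaches-0 (suc n) Pn+1 = reaches-0 n (P↓ n Pn+1)
  run-length-spec {P} P? P↓ (suc M) ¬PM+1 n with P? 0
  ... | no ¬P0 = run-length-spec P? P↓ zero ¬P0 n
  ... | yes P0 with n
  ...   | zero  = mk⇔ (λ _ → s≤s z≤n) (λ _ → P0)
  ...   | suc n′ = ⇔-trans (run-length-spec (λ n → P? (suc n)) (λ n → P↓ (suc n)) M ¬PM+1 n′)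
                           (mk⇔ s≤s ℕP.≤-pred)

  sumℤ : ℕ → (ℕ → ℤ) → ℤ
  sumℤ zero    f = 0ℤ
  sumℤ (suc n) f = sumℤ n f + f n

  sumℤ-nonneg : ∀ n f → (∀ r → r ℕ.< n → 0ℤ ≤ f r) → 0ℤ ≤ sumℤ n f
  sumℤ-nonneg zero    f f≥0 = ℤP.≤-refl
  sumℤ-nonneg (suc n) f f≥0 = sumℤ-nonneg n f (λ r r<n → f≥0 r (ℕP.m<n⇒m<1+n r<n)) ⊕ f≥0 n (ℕP.n<1+n n)

  sumℤ-change : ∀ n f g → sumℤ n g ≡ sumℤ n f + sumℤ n (λ r → g r - f r)
  sumℤ-change zero    f g = refl
  sumℤ-change (suc n) f g = trans (cong (_+ g n) (sumℤ-change n f g))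
                                  (gap (sumℤ n f) (sumℤ n (λ r → g r - f r)) (f n) (g n))
    where
    gap : ∀ a b c d → a + b + d ≡ (a + c) + (b + (d - c))
    gap = solve-∀

  sumℤ-zero : ∀ n d → (∀ r → r ℕ.< n → d r ≡ 0ℤ) → sumℤ n d ≡ 0ℤ
  sumℤ-zero zero    d d≡0 = refl
  sumℤ-zero (suc n) d d≡0 = cong₂ _+_ (sumℤ-zero n d (λ r r<n → d≡0 r (ℕP.m<n⇒m<1+n r<n))) (d≡0 n (ℕP.n<1+n n))

  sumℤ-single : ∀ n d j → j ℕ.< n → (∀ r → r ℕ.< n → r ≢ j → d r ≡ 0ℤ) → sumℤ n d ≡ d j
  sumℤ-single (suc m) d j j<1+m d≡0 with j ℕ.≟ m
  ... | yes refl = trans (cong (_+ d j) (sumℤ-zero j d (λ r r<j → d≡0 r (ℕP.m<n⇒m<1+n r<j) (ℕP.<⇒≢ r<j))))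
                         (ℤP.+-identityˡ (d j))
  ... | no j≢m = trans (cong₂ _+_ (sumℤ-single m d j (ℕP.≤∧≢⇒< (ℕP.≤-pred j<1+m) j≢m)
                                                (λ r r<m → d≡0 r (ℕP.m<n⇒m<1+n r<m)))
                                  (d≡0 m (ℕP.n<1+n m) (j≢m ∘′ sym)))
                       (ℤP.+-identityʳ (d j))

  sumℤ-adjacent : ∀ n d j → suc j ℕ.< n → (∀ r → r ℕ.< n → r ≢ j → r ≢ suc j → d r ≡ 0ℤ) →
                  sumℤ n d ≡ d j + d (suc j)
  sumℤ-adjacent (suc m) d j j+1<1+m d≡0 with suc j ℕ.≟ m
  ... | yes refl = cong (_+ d (suc j))
                        (sumℤ-single (suc j) d j (ℕP.n<1+n j)
                                     (λ r r<j+1 r≢j → d≡0 r (ℕP.m<n⇒m<1+n r<j+1) r≢j (ℕP.<⇒≢ r<j+1)))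
  ... | no j+1≢m = trans (cong₂ _+_ (sumℤ-adjacent m d j j+1<m (λ r r<m → d≡0 r (ℕP.m<n⇒m<1+n r<m)))
                                    (d≡0 m (ℕP.n<1+n m) (ℕP.<⇒≢ j<m ∘′ sym) (j+1≢m ∘′ sym)))
                         (ℤP.+-identityʳ (d j + d (suc j)))
    where
    j+1<m : suc j ℕ.< m
    j+1<m = ℕP.≤∧≢⇒< (ℕP.≤-pred j+1<1+m) j+1≢m
    j<m : j ℕ.< m
    j<m = ℕP.<-trans (ℕP.n<1+n j) j+1<m

  select : ∀ {P Q : Set} → Dec P → Dec Q → ℤ → ℤ → ℤ → ℤ
  select (yes _) _       a b c = a
  select (no _)  (yes _) a b c = b
  select (no _)  (no _)  a b c = c

  select-yes : ∀ {P Q : Set} (P? : Dec P) (Q? : Dec Q) {a b c} → P → select P? Q? a b c ≡ a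
  select-yes (yes _) _ _  = refl
  select-yes (no ¬p) _ p = ⊥-elim (¬p p)

  select-no-yes : ∀ {P Q : Set} (P? : Dec P) (Q? : Dec Q) {a b c} → ¬ P → Q → select P? Q? a b c ≡ b
  select-no-yes (yes p) _       ¬p _ = ⊥-elim (¬p p)
  select-no-yes (no _)  (yes _) _  _ = refl
  select-no-yes (no _)  (no ¬q) _  q = ⊥-elim (¬q q)

  select-no-no : ∀ {P Q : Set} (P? : Dec P) (Q? : Dec Q) {a b c} → ¬ P → ¬ Q → select P? Q? a b c ≡ c
  select-no-no (yes p) _       ¬p _  = ⊥-elim (¬p p)
  select-no-no (no _)  (yes q) _  ¬q = ⊥-elim (¬q q)
  select-no-no (no _)  (no _)  _  _  = refl

  StrictlyDecreasing : (ℕ → ℤ) → Set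
  StrictlyDecreasing a = ∀ i j → 1 ℕ.≤ i → i ℕ.< j → a j < a i

  ValuesAmong : (ℕ → ℤ) → (ℕ → ℤ) → Set
  ValuesAmong a b = ∀ i → 1 ℕ.≤ i → ∃[ j ] (1 ℕ.≤ j × a i ≡ b j)

  module _ {a b : ℕ → ℤ} (a↓ : StrictlyDecreasing a) (b↓ : StrictlyDecreasing b) where

    agreeing-below⇒≤ : ValuesAmong a b → ∀ i → (∀ k → k ℕ.< i → 1 ℕ.≤ k → a k ≡ b k) →
                       1 ℕ.≤ i → a i ≤ b i
    agreeing-below⇒≤ a⊆b i agree 1≤i with a⊆b i 1≤i
    ... | j , 1≤j , ai≡bj with ℕP.<-cmp j i
    ...   | tri< j<i _ _ = ⊥-elim (ℤP.<-irrefl (trans ai≡bj (sym (agree j j<i 1≤j))) (a↓ j i 1≤j j<i))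
    ...   | tri≈ _ refl _ = ℤP.≤-reflexive ai≡bj
    ...   | tri> _ _ i<j = ℤP.<⇒≤ (subst (_< b i) (sym ai≡bj) (b↓ i j 1≤i i<j))

  strictly-decreasing-same-values⇒≡ :
    ∀ {a b} → StrictlyDecreasing a → StrictlyDecreasing b → ValuesAmong a b → ValuesAmong b a →
    ∀ i → 1 ℕ.≤ i → a i ≡ b i
  strictly-decreasing-same-values⇒≡ {a} {b} a↓ b↓ a⊆b b⊆a =
    <-rec (λ i → 1 ℕ.≤ i → a i ≡ b i) λ i agree 1≤i →
      ℤP.≤-antisym (agreeing-below⇒≤ a↓ b↓ a⊆b i (λ k k<i → agree k<i) 1≤i)
                   (agreeing-below⇒≤ b↓ a↓ b⊆a i (λ k k<i 1≤k → sym (agree k<i 1≤k)) 1≤i)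

  -- Partitions, beads and holes

  countAtLeast : ℕ → List ℕ → ℕ
  countAtLeast j xs = length (filter (j ℕ.≤?_) xs)

  countAtLeast-accept : ∀ {j y} ys → j ℕ.≤ y → countAtLeast j (y ∷ ys) ≡ suc (countAtLeast j ys)
  countAtLeast-accept {j} ys j≤y = cong length (ListP.filter-accept (j ℕ.≤?_) j≤y)

  countAtLeast-reject : ∀ {j y} ys → ¬ j ℕ.≤ y → countAtLeast j (y ∷ ys) ≡ countAtLeast j ys
  countAtLeast-reject {j} ys j≰y = cong length (ListP.filter-reject (j ℕ.≤?_) j≰y)

  nth-≤-head : ∀ {x} xs → Linked ℕ._≥_ (x ∷ xs) → ∀ k → nth xs k ℕ.≤ x
  nth-≤-head []       _          k             = z≤n
  nth-≤-head (y ∷ ys) (x≥y ∷ _)  zero          = z≤n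
  nth-≤-head (y ∷ ys) (x≥y ∷ _)  (suc zero)    = x≥y
  nth-≤-head (y ∷ ys) (x≥y ∷ ys↓) (suc (suc k)) = ℕP.≤-trans (nth-≤-head ys ys↓ (suc k)) x≥y

  countAtLeast-above-head : ∀ {x} xs j → Linked ℕ._≥_ (x ∷ xs) → x ℕ.< j → countAtLeast j xs ≡ 0
  countAtLeast-above-head []       j _           x<j = refl
  countAtLeast-above-head (y ∷ ys) j (x≥y ∷ ys↓) x<j with j ℕ.≤? y
  ... | yes j≤y = ⊥-elim (ℕP.<⇒≱ x<j (ℕP.≤-trans j≤y x≥y))
  ... | no j≰y  = trans (countAtLeast-reject ys j≰y)
                        (countAtLeast-above-head ys j ys↓ (ℕP.≤-<-trans x≥y x<j))

  ≤nth⇒<countAtLeast : ∀ xs → Linked ℕ._≥_ xs → ∀ i j → 1 ℕ.≤ j →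
                       j ℕ.≤ nth xs (suc i) → suc i ℕ.≤ countAtLeast j xs
  ≤nth⇒<countAtLeast []       _   i j (s≤s _) ()
  ≤nth⇒<countAtLeast (x ∷ xs) xs↓ i j 1≤j j≤ with j ℕ.≤? x
  ≤nth⇒<countAtLeast (x ∷ xs) xs↓ zero    j 1≤j j≤ | yes j≤x
    rewrite countAtLeast-accept xs j≤x = s≤s z≤n
  ≤nth⇒<countAtLeast (x ∷ xs) xs↓ (suc i) j 1≤j j≤ | yes j≤x
    rewrite countAtLeast-accept xs j≤x = s≤s (≤nth⇒<countAtLeast xs (Linked.tail xs↓) i j 1≤j j≤)
  ≤nth⇒<countAtLeast (x ∷ xs) xs↓ zero    j 1≤j j≤ | no j≰x = ⊥-elim (j≰x j≤)
  ≤nth⇒<countAtLeast (x ∷ xs) xs↓ (suc i) j 1≤j j≤ | no j≰x =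
    ⊥-elim (j≰x (ℕP.≤-trans j≤ (nth-≤-head xs xs↓ (suc i))))

  <countAtLeast⇒≤nth : ∀ xs → Linked ℕ._≥_ xs → ∀ i j →
                       suc i ℕ.≤ countAtLeast j xs → j ℕ.≤ nth xs (suc i)
  <countAtLeast⇒≤nth []       _   i j ()
  <countAtLeast⇒≤nth (x ∷ xs) xs↓ i j < = go (j ℕ.≤? x) i <
    where
    go : Dec (j ℕ.≤ x) → ∀ i → suc i ℕ.≤ countAtLeast j (x ∷ xs) → j ℕ.≤ nth (x ∷ xs) (suc i)
    go (yes j≤x) zero    _ = j≤x
    go (yes j≤x) (suc i) < = <countAtLeast⇒≤nth xs (Linked.tail xs↓) i j
                               (ℕP.≤-pred (subst (suc (suc i) ℕ.≤_) (countAtLeast-accept xs j≤x) <))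
    go (no j≰x)  i       < with subst (suc i ℕ.≤_)
                                      (trans (countAtLeast-reject xs j≰x)
                                             (countAtLeast-above-head xs j xs↓ (ℕP.≰⇒> j≰x))) <
    ... | ()

  nth-beyond-length : ∀ xs i → length xs ℕ.< i → nth xs i ≡ 0
  nth-beyond-length []       i             _       = refl
  nth-beyond-length (x ∷ xs) (suc (suc i)) (s≤s n<i) = nth-beyond-length xs (suc i) n<i

  bead : Partition → ℕ → ℤ
  bead p i = + part p i - + i

  hole : Partition → ℕ → ℤ
  hole p j = + j - + 1 - + conjPart p j

  antitone⇒shifted-strictly-decreasing :
    (f : ℕ → ℕ) → (∀ i j → 1 ℕ.≤ i → i ℕ.≤ j → f j ℕ.≤ f i) → StrictlyDecreasing (λ i → + f i - + i)
  antitone⇒shifted-strictly-decreasing f f↓ i j 1≤i i<j =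
    suc[i]≤j⇒i<j (≤-by-gap (+≤+ (f↓ i j 1≤i (ℕP.<⇒≤ i<j)) ⊕ +≤+ i<j) (gap (+ f i) (+ f j) (+ i) (+ j)))
    where
    gap : ∀ x y i j → (x - i) - (1ℤ + (y - j)) ≡ (x + j) - (y + (1ℤ + i))
    gap = solve-∀

  module _ (p : Partition) where

    ≤part⇒≤conjPart : ∀ i j → 1 ℕ.≤ i → 1 ℕ.≤ j → j ℕ.≤ part p i → i ℕ.≤ conjPart p j
    ≤part⇒≤conjPart (suc i) j _ 1≤j = ≤nth⇒<countAtLeast (parts p) (decreasing p) i j 1≤j

    ≤conjPart⇒≤part : ∀ i j → 1 ℕ.≤ i → i ℕ.≤ conjPart p j → j ℕ.≤ part p i
    ≤conjPart⇒≤part (suc i) j _ = <countAtLeast⇒≤nth (parts p) (decreasing p) i j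

    part-antitone : ∀ i j → 1 ℕ.≤ i → i ℕ.≤ j → part p j ℕ.≤ part p i
    part-antitone i j 1≤i i≤j with part p j in eq
    ... | zero  = z≤n
    ... | suc v = ≤conjPart⇒≤part i (suc v) 1≤i
                    (ℕP.≤-trans i≤j (≤part⇒≤conjPart j (suc v) (ℕP.≤-trans 1≤i i≤j) (s≤s z≤n)
                                                      (ℕP.≤-reflexive (sym eq))))

    conjPart-antitone : ∀ i j → 1 ℕ.≤ i → i ℕ.≤ j → conjPart p j ℕ.≤ conjPart p i
    conjPart-antitone i j 1≤i i≤j with conjPart p j in eq
    ... | zero  = z≤n
    ... | suc v = ≤part⇒≤conjPart (suc v) i (s≤s z≤n) 1≤i
                    (ℕP.≤-trans i≤j (≤conjPart⇒≤part (suc v) j (s≤s z≤n) (ℕP.≤-reflexive (sym eq))))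

    hook≡bead-hole : ∀ i j → j ℕ.≤ part p i → i ℕ.≤ conjPart p j → + hook p i j ≡ bead p i - hole p j
    hook≡bead-hole i j j≤λi i≤λ′j = begin
      + hook p i j                                         ≡⟨ ℤP.pos-+ (λi-j ℕ.+ λ′j-i) 1 ⟩
      + (λi-j ℕ.+ λ′j-i) + + 1                             ≡⟨ cong (_+ + 1) (ℤP.pos-+ λi-j λ′j-i) ⟩
      + λi-j + + λ′j-i + + 1                               ≡⟨ cong₂ (λ u v → u + v + + 1) (+∸ j≤λi) (+∸ i≤λ′j) ⟩
      (+ part p i - + j) + (+ conjPart p j - + i) + + 1    ≡⟨ gap (+ part p i) (+ conjPart p j) (+ i) (+ j) ⟩
      bead p i - hole p j                                  ∎
      where
      open ≡-Reasoning
      λi-j = part p i ℕ.∸ j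
      λ′j-i = conjPart p j ℕ.∸ i
      gap : ∀ a k i j → (a - j) + (k - i) + + 1 ≡ (a - i) - (j - + 1 - k)
      gap = solve-∀

    hole≤bead⇒≤conjPart : ∀ i j → 1 ℕ.≤ i → 1 ℕ.≤ j → hole p j ≤ bead p i → i ℕ.≤ conjPart p j
    hole≤bead⇒≤conjPart i j 1≤i 1≤j hole≤bead with i ℕ.≤? conjPart p j
    ... | yes i≤λ′j = i≤λ′j
    ... | no i≰λ′j = ⊥-elim (absurd-by-gap (λi<j ⊕ +≤+ (ℕP.≰⇒> i≰λ′j) ⊕ hole≤bead)
                                           (gap (+ part p i) (+ i) (+ j) (+ conjPart p j)))
      where
      λi<j : 1ℤ + + part p i ≤ + j
      λi<j = +≤+ (ℕP.≰⇒> λ j≤λi → i≰λ′j (≤part⇒≤conjPart i j 1≤i 1≤j j≤λi))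
      gap : ∀ a i j k → 0ℤ - + 1 ≡ (j + i + (a - i)) - ((1ℤ + a) + (1ℤ + k) + (j - + 1 - k))
      gap = solve-∀

    -- A bead on the hole p j would sit at both ends of a hook of length 0.
    hole-∉-beta0 : ∀ j → 1 ℕ.≤ j → ¬ beta0 p (hole p j)
    hole-∉-beta0 j 1≤j (i , 1≤i , hole≡bead) =
      ℕP.1+n≢0 (ℕP.m+n≡0⇒n≡0 (part p i ℕ.∸ j ℕ.+ (conjPart p j ℕ.∸ i)) hook≡0)
      where
      i≤λ′j = hole≤bead⇒≤conjPart i j 1≤i 1≤j (ℤP.≤-reflexive hole≡bead)
      j≤λi = ≤conjPart⇒≤part i j 1≤i i≤λ′j
      hook≡0 : hook p i j ≡ 0
      hook≡0 = ℤP.+-injective (trans (hook≡bead-hole i j j≤λi i≤λ′j)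
                                     (trans (cong (λ h → bead p i - h) hole≡bead) (ℤP.+-inverseʳ (bead p i))))

    beta0-below-length : ∀ z → z + + length (parts p) < 0ℤ → beta0 p z
    beta0-below-length z z+n<0 = i , 1≤i , z≡bead
      where
      n = length (parts p)
      0≤-z : 0ℤ ≤ - z
      0≤-z = ≤-by-gap (i<j⇒suc[i]≤j z+n<0 ⊕ 0≤+ n ⊕ 0≤+ 1) (gap z (+ n))
        where
        gap : ∀ z n → - z - 0ℤ ≡ (0ℤ + n + + 1) - (1ℤ + (z + n) + 0ℤ + 0ℤ)
        gap = solve-∀
      i : ℕ
      i = ℤ.∣ - z ∣
      +i≡-z : + i ≡ - z
      +i≡-z = ℤP.0≤i⇒+∣i∣≡i 0≤-z
      n<i : n ℕ.< i
      n<i = ℤP.drop‿+≤+ (≤-by-gap (i<j⇒suc[i]≤j z+n<0 ⊕ ℤP.≤-reflexive (sym +i≡-z)) (gap z (+ n) (+ i)))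
        where
        gap : ∀ z n i → i - (1ℤ + n) ≡ (0ℤ + i) - (1ℤ + (z + n) + (- z))
        gap = solve-∀
      1≤i : 1 ℕ.≤ i
      1≤i = ℕP.≤-trans (s≤s z≤n) n<i
      z≡bead : z ≡ bead p i
      z≡bead rewrite nth-beyond-length (parts p) i n<i =
        trans (sym (ℤP.neg-involutive z)) (trans (cong -_ (sym +i≡-z)) (sym (ℤP.+-identityˡ (- + i))))

    conjPart-≡ : ∀ j k → 1 ℕ.≤ j → (1 ℕ.≤ k → j ℕ.≤ part p k) → part p (suc k) ℕ.< j →
                 conjPart p j ≡ k
    conjPart-≡ j k 1≤j lower upper = ℕP.≤-antisym λ′j≤k (k≤λ′j k lower)
      where
      λ′j≤k : conjPart p j ℕ.≤ k
      λ′j≤k = ℕP.≤-pred (ℕP.≰⇒> λ k<λ′j → ℕP.<⇒≱ upper (≤conjPart⇒≤part (suc k) j (s≤s z≤n) k<λ′j))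
      k≤λ′j : ∀ k → (1 ℕ.≤ k → j ℕ.≤ part p k) → k ℕ.≤ conjPart p j
      k≤λ′j zero    _     = z≤n
      k≤λ′j (suc k) lower = ≤part⇒≤conjPart (suc k) j (s≤s z≤n) 1≤j (lower (s≤s z≤n))

    ∉beta0⇒hole : ∀ z → ¬ beta0 p z → ∃[ j ] (1 ℕ.≤ j × z ≡ hole p j)
    ∉beta0⇒hole z z∉β = j , 1≤j , z≡hole
      where
      n = length (parts p)
      BeadBelow : ℕ → Set
      BeadBelow m = bead p (suc m) < z
      bead-n+1-below : BeadBelow n
      bead-n+1-below rewrite nth-beyond-length (parts p) (suc n) (ℕP.n<1+n n) =
        suc[i]≤j⇒i<j (≤-by-gap (ℤP.≮⇒≥ λ z+n<0 → z∉β (beta0-below-length z z+n<0)) (gap z (+ n)))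
        where
        gap : ∀ z n → z - (1ℤ + (0ℤ - (1ℤ + n))) ≡ (z + n) - 0ℤ
        gap = solve-∀
      run = start-of-run BeadBelow (λ m → bead p (suc m) ℤP.<? z) n bead-n+1-below
      k : ℕ
      k = proj₁ run
      w : ℤ
      w = z + (1ℤ + + k)
      1≤w : + 1 ≤ w
      1≤w = ≤-by-gap (i<j⇒suc[i]≤j (proj₁ (proj₂ run)) ⊕ 0≤+ (part p (suc k)))
                     (gap z (+ k) (+ part p (suc k)))
        where
        gap : ∀ z k a → (z + (1ℤ + k)) - + 1 ≡ (z + a) - (1ℤ + (a - (1ℤ + k)) + 0ℤ)
        gap = solve-∀
      j : ℕ
      j = ℤ.∣ w ∣
      +j≡w : + j ≡ w
      +j≡w = ℤP.0≤i⇒+∣i∣≡i (ℤP.≤-trans (0≤+ 1) 1≤w)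
      1≤j : 1 ℕ.≤ j
      1≤j = ℤP.drop‿+≤+ (subst (+ 1 ≤_) (sym +j≡w) 1≤w)
      upper : part p (suc k) ℕ.< j
      upper = ℤP.drop‿+≤+ (≤-by-gap (i<j⇒suc[i]≤j (proj₁ (proj₂ run)) ⊕ ℤP.≤-reflexive (sym +j≡w))
                                    (gap z (+ k) (+ j) (+ part p (suc k))))
        where
        gap : ∀ z k j a → j - (1ℤ + a) ≡ (z + j) - (1ℤ + (a - (1ℤ + k)) + (z + (1ℤ + k)))
        gap = solve-∀
      lower : ∀ m → m ≡ k → 1 ℕ.≤ m → j ℕ.≤ part p m
      lower (suc k′) k′+1≡k _ = ℤP.drop‿+≤+ (≤-by-gap (i<j⇒suc[i]≤j z<bead ⊕ ℤP.≤-reflexive +j≡w′)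
                                                     (gap z (+ k′) (+ j) (+ part p (suc k′))))
        where
        z<bead : z < bead p (suc k′)
        z<bead = ℤP.≤∧≢⇒< (ℤP.≮⇒≥ (proj₂ (proj₂ run) k′ k′+1≡k)) (λ z≡ → z∉β (suc k′ , s≤s z≤n , z≡))
        +j≡w′ : + j ≡ z + (1ℤ + (1ℤ + + k′))
        +j≡w′ = trans +j≡w (cong (λ v → z + (1ℤ + + v)) (sym k′+1≡k))
        gap : ∀ z k j a → a - j ≡ ((a - (1ℤ + k)) + (z + (1ℤ + (1ℤ + k)))) - ((1ℤ + z) + j)
        gap = solve-∀
      z≡hole : z ≡ hole p j
      z≡hole = trans (gap z (+ k))
                     (cong₂ (λ a b → a - + 1 - + b) (sym +j≡w)
                            (sym (conjPart-≡ j k 1≤j (lower k refl) upper)))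
        where
        gap : ∀ z k → z ≡ (z + (1ℤ + k)) - + 1 - k
        gap = solve-∀

    beta0? : ∀ z → Dec (beta0 p z)
    beta0? z with z + + length (parts p) ℤP.<? 0ℤ
    ... | yes z+n<0 = yes (beta0-below-length z z+n<0)
    ... | no z+n≮0 with ℕP.anyUpTo? (λ m → z ℤ.≟ bead p (suc m)) (length (parts p))
    ...   | yes (m , _ , z≡) = yes (suc m , s≤s z≤n , z≡)
    ...   | no ¬early = no λ { (suc m , _ , z≡) → late m z≡ }
      where
      n = length (parts p)
      late : ∀ m → z ≢ bead p (suc m)
      late m z≡ with m ℕ.<? n
      ... | yes m<n = ¬early (m , m<n , z≡)
      ... | no m≮n = absurd-by-gap (ℤP.≮⇒≥ z+n≮0 ⊕ +≤+ (ℕP.≮⇒≥ m≮n) ⊕ ℤP.≤-reflexive z≡0-m-1)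
                                   (gap z (+ n) (+ m))
        where
        z≡0-m-1 : z ≡ 0ℤ - + suc m
        z≡0-m-1 = subst (λ v → z ≡ + v - + suc m)
                        (nth-beyond-length (parts p) (suc m) (s≤s (ℕP.≮⇒≥ m≮n))) z≡
        gap : ∀ z n m → 0ℤ - + 1 ≡ ((z + n) + m + (0ℤ - (1ℤ + m))) - (0ℤ + n + z)
        gap = solve-∀

  beta0-radius : Partition → ℕ
  beta0-radius p = length (parts p) ℕ.+ part p 1

  beta0-below-radius : ∀ p z → z + + beta0-radius p < 0ℤ → beta0 p z
  beta0-below-radius p z z+R<0 =
    beta0-below-length p z (suc[i]≤j⇒i<j (≤-by-gap (i<j⇒suc[i]≤j z+R<0 ⊕ 0≤+ (part p 1))
                                                   (gap z (+ length (parts p)) (+ part p 1))))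
    where
    gap : ∀ z n a → 0ℤ - (1ℤ + (z + n)) ≡ (0ℤ + a) - (1ℤ + (z + (n + a)) + 0ℤ)
    gap = solve-∀

  beta0-above-radius : ∀ p z → + beta0-radius p ≤ z → ¬ beta0 p z
  beta0-above-radius p z R≤z (i , 1≤i , z≡) =
    absurd-by-gap (R≤z ⊕ +≤+ (part-antitone p 1 i (s≤s z≤n) 1≤i) ⊕ +≤+ 1≤i ⊕ ℤP.≤-reflexive z≡
                   ⊕ 0≤+ (length (parts p)))
                  (gap z (+ length (parts p)) (+ part p 1) (+ part p i) (+ i))
    where
    gap : ∀ z n a b i → 0ℤ - + 1 ≡ (z + a + i + (b - i) + n) - ((n + a) + b + + 1 + z + 0ℤ)
    gap = solve-∀

  -- The reflections s_i

  period : ℕ → ℤ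
  period l = + (2 ℕ.* l)

  module _ (l i : ℕ) where

    CondSigned : ℤ → Set
    CondSigned z = (period l ℤD.∣ z - + i) ⊎ (period l ℤD.∣ z + + i)

    Cond⇔CondSigned : ∀ z → Cond l i z ⇔ CondSigned z
    Cond⇔CondSigned z = mk⇔ (Sum.map ℤD.∣ᵤ⇒∣ ℤD.∣ᵤ⇒∣) (Sum.map ℤD.∣⇒∣ᵤ ℤD.∣⇒∣ᵤ)

    Cond? : ∀ z → Dec (Cond l i z)
    Cond? z = Dec.map (⇔-sym (Cond⇔CondSigned z))
                      ((period l ℤD.∣? (z - + i)) Dec.⊎-dec (period l ℤD.∣? (z + + i)))

    private
      divides-by-ring : ∀ {a b} → a ≡ b → period l ℤD.∣ a → period l ℤD.∣ b
      divides-by-ring = subst (period l ℤD.∣_)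

    Cond-periodic : ∀ z k → Cond l i z → Cond l i (z + k * period l)
    Cond-periodic z k c =
      from (Cond⇔CondSigned (z + k * period l))
           (Sum.map (shift (gap₋ z k (+ i) (period l))) (shift (gap₊ z k (+ i) (period l))) (to (Cond⇔CondSigned z) c))
      where
      shift : ∀ {a b} → a + k * period l ≡ b → period l ℤD.∣ a → period l ℤD.∣ b
      shift eq d = divides-by-ring eq (ℤD.∣m∣n⇒∣m+n d (ℤD.∣n⇒∣m*n k (ℤD.∣-refl {period l})))
      gap₋ : ∀ z k i e → (z - i) + k * e ≡ (z + k * e) - i
      gap₋ = solve-∀
      gap₊ : ∀ z k i e → (z + i) + k * e ≡ (z + k * e) + i
      gap₊ = solve-∀

    Cond-mod-period : ∀ {x} r q → x ≡ r + q * period l → Cond l i x ⇔ Cond l i r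
    Cond-mod-period {x} r q x≡ =
      mk⇔ (λ c → subst (Cond l i) (trans (cong (_+ - q * period l) x≡) (gap r q (period l))) (Cond-periodic x (- q) c))
          (λ c → subst (Cond l i) (sym x≡) (Cond-periodic r q c))
      where
      gap : ∀ r q e → (r + q * e) + - q * e ≡ r
      gap = solve-∀

    Cond-down : ∀ z → Cond l i z ⇔ Cond l i (z - period l)
    Cond-down z = Cond-mod-period (z - period l) 1ℤ (gap z (period l))
      where
      gap : ∀ z e → z ≡ (z - e) + 1ℤ * e
      gap = solve-∀

    Cond-self : Cond l i (+ i)
    Cond-self = inj₁ (subst (2 ℕ.* l ℕD.∣_) (sym (cong ℤ.∣_∣ (ℤP.+-inverseʳ (+ i)))) (ℕD._∣0 (2 ℕ.* l)))

    Cond-neg : ∀ z → Cond l i z → Cond l i (- z)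
    Cond-neg z c =
      from (Cond⇔CondSigned (- z))
           (Sum.swap (Sum.map (negate (gap₋ z (+ i))) (negate (gap₊ z (+ i))) (to (Cond⇔CondSigned z) c)))
      where
      negate : ∀ {a b} → - a ≡ b → period l ℤD.∣ a → period l ℤD.∣ b
      negate eq d = divides-by-ring eq (ℤD.∣m⇒∣-m d)
      gap₋ : ∀ z i → - (z - i) ≡ - z + i
      gap₋ = solve-∀
      gap₊ : ∀ z i → - (z + i) ≡ - z - i
      gap₊ = solve-∀

    period-∤-odd : ∀ t → ¬ (period l ℤD.∣ 1ℤ + t * + 2)
    period-∤-odd t d = ℕP.1+n≢n (ℕD.∣1⇒≡1 (ℤD.∣⇒∣ᵤ (ℤD.∣m+n∣n⇒∣m {+ 2} {1ℤ} 2∣odd (ℤD.∣n⇒∣m*n t (ℤD.∣-refl {+ 2})))))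
      where
      2∣odd : + 2 ℤD.∣ 1ℤ + t * + 2
      2∣odd = ℤD.∣-trans (ℤD.divides (+ l) (trans (ℤP.pos-* 2 l) (ℤP.*-comm (+ 2) (+ l)))) d

    Cond-not-adjacent : ∀ z → Cond l i z → ¬ Cond l i (z + + 1)
    Cond-not-adjacent z c c′ with to (Cond⇔CondSigned z) c | to (Cond⇔CondSigned (z + + 1)) c′
    ... | inj₁ d | inj₁ d′ = period-∤-odd 0ℤ (divides-by-ring (gap z (+ i)) (ℤD.∣m∣n⇒∣m-n d′ d))
      where gap : ∀ z i → ((z + + 1) - i) - (z - i) ≡ 1ℤ + 0ℤ * + 2
            gap = solve-∀
    ... | inj₁ d | inj₂ d′ = period-∤-odd (+ i) (divides-by-ring (gap z (+ i)) (ℤD.∣m∣n⇒∣m-n d′ d))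
      where gap : ∀ z i → ((z + + 1) + i) - (z - i) ≡ 1ℤ + i * + 2
            gap = solve-∀
    ... | inj₂ d | inj₁ d′ = period-∤-odd (- + i) (divides-by-ring (gap z (+ i)) (ℤD.∣m∣n⇒∣m-n d′ d))
      where gap : ∀ z i → ((z + + 1) - i) - (z + i) ≡ 1ℤ + - i * + 2
            gap = solve-∀
    ... | inj₂ d | inj₂ d′ = period-∤-odd 0ℤ (divides-by-ring (gap z (+ i)) (ℤD.∣m∣n⇒∣m-n d′ d))
      where gap : ∀ z i → ((z + + 1) + i) - (z + i) ≡ 1ℤ + 0ℤ * + 2
            gap = solve-∀

  mirror : ℤ → ℤ
  mirror x = - x - + 1

  mirror-involutive : ∀ x → mirror (mirror x) ≡ x
  mirror-involutive = gap
    where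
    gap : ∀ x → - (- x - + 1) - + 1 ≡ x
    gap = solve-∀

  SelfDual : Subset → Set
  SelfDual S = ∀ x → S x ⇔ (¬ S (mirror x))

  DownClosed : ℕ → Subset → Set
  DownClosed l S = ∀ x → S x → S (x - period l)

  infix 4 _≐_
  _≐_ : Subset → Subset → Set
  S ≐ T = ∀ x → S x ⇔ T x

  ≐-sym : ∀ {S T} → S ≐ T → T ≐ S
  ≐-sym S≐T x = ⇔-sym (S≐T x)

  ≐-trans : ∀ {S T U} → S ≐ T → T ≐ U → S ≐ U
  ≐-trans S≐T T≐U x = ⇔-trans (S≐T x) (T≐U x)

  SelfDual-resp-≐ : ∀ {S T} → S ≐ T → SelfDual S → SelfDual T
  SelfDual-resp-≐ S≐T sd x = ⇔-trans (⇔-sym (S≐T x)) (⇔-trans (sd x) (¬-cong-⇔ (S≐T (mirror x))))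

  module _ (l i : ℕ) (S : Subset) where

    sOp-upper : ∀ y → Cond l i y → sOp l i S y ⇔ S (y - + 1)
    sOp-upper y c = mk⇔ to′ (λ s → inj₁ (c , s))
      where
      to′ : sOp l i S y → S (y - + 1)
      to′ (inj₁ (_ , s))         = s
      to′ (inj₂ (inj₁ (¬c , _))) = ⊥-elim (¬c c)
      to′ (inj₂ (inj₂ (¬c , _))) = ⊥-elim (¬c c)

    sOp-lower : ∀ y → ¬ Cond l i y → Cond l i (y + + 1) → sOp l i S y ⇔ S (y + + 1)
    sOp-lower y ¬c c₁ = mk⇔ to′ (λ s → inj₂ (inj₁ (¬c , c₁ , s)))
      where
      to′ : sOp l i S y → S (y + + 1)
      to′ (inj₁ (c , _))               = ⊥-elim (¬c c)
      to′ (inj₂ (inj₁ (_ , _ , s)))    = s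
      to′ (inj₂ (inj₂ (_ , ¬c₁ , _))) = ⊥-elim (¬c₁ c₁)

    sOp-fixed : ∀ y → ¬ Cond l i y → ¬ Cond l i (y + + 1) → sOp l i S y ⇔ S y
    sOp-fixed y ¬c ¬c₁ = mk⇔ to′ (λ s → inj₂ (inj₂ (¬c , ¬c₁ , s)))
      where
      to′ : sOp l i S y → S y
      to′ (inj₁ (c , _))            = ⊥-elim (¬c c)
      to′ (inj₂ (inj₁ (_ , c₁ , _))) = ⊥-elim (¬c₁ c₁)
      to′ (inj₂ (inj₂ (_ , _ , s)))  = s

    sOp-preserves-SelfDual : SelfDual S → SelfDual (sOp l i S)
    sOp-preserves-SelfDual sd y with Cond? l i y | Cond? l i (y + + 1)
    ... | yes c | _ = begin
      sOp l i S y               ≈⟨ sOp-upper y c ⟩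
      S (y - + 1)               ≈⟨ sd (y - + 1) ⟩
      (¬ S (mirror (y - + 1)))  ≡⟨ cong (λ v → ¬ S v) (gap y) ⟩
      (¬ S (mirror y + + 1))    ≈⟨ ¬-cong-⇔ (sOp-lower (mirror y) ¬c′ c′) ⟨
      (¬ sOp l i S (mirror y))  ∎
      where
      open ⇔-Reasoning
      gap : ∀ y → - (y - + 1) - + 1 ≡ (- y - + 1) + + 1
      gap = solve-∀
      c′ : Cond l i (mirror y + + 1)
      c′ = subst (Cond l i) (gap′ y) (Cond-neg l i y c)
        where
        gap′ : ∀ y → - y ≡ (- y - + 1) + + 1
        gap′ = solve-∀
      ¬c′ : ¬ Cond l i (mirror y)
      ¬c′ c″ = Cond-not-adjacent l i (mirror y) c″ c′
    ... | no ¬c | yes c₁ = begin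
      sOp l i S y               ≈⟨ sOp-lower y ¬c c₁ ⟩
      S (y + + 1)               ≈⟨ sd (y + + 1) ⟩
      (¬ S (mirror (y + + 1)))  ≡⟨ cong (λ v → ¬ S v) (gap y) ⟩
      (¬ S (mirror y - + 1))    ≈⟨ ¬-cong-⇔ (sOp-upper (mirror y) c′) ⟨
      (¬ sOp l i S (mirror y))  ∎
      where
      open ⇔-Reasoning
      gap : ∀ y → - (y + + 1) - + 1 ≡ (- y - + 1) - + 1
      gap = solve-∀
      c′ : Cond l i (mirror y)
      c′ = subst (Cond l i) (gap′ y) (Cond-neg l i (y + + 1) c₁)
        where
        gap′ : ∀ y → - (y + + 1) ≡ - y - + 1
        gap′ = solve-∀
    ... | no ¬c | no ¬c₁ = begin
      sOp l i S y               ≈⟨ sOp-fixed y ¬c ¬c₁ ⟩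
      S y                       ≈⟨ sd y ⟩
      (¬ S (mirror y))          ≈⟨ ¬-cong-⇔ (sOp-fixed (mirror y) ¬c′ ¬c₁′) ⟨
      (¬ sOp l i S (mirror y))  ∎
      where
      open ⇔-Reasoning
      ¬c′ : ¬ Cond l i (mirror y)
      ¬c′ c′ = ¬c₁ (subst (Cond l i) (gap y) (Cond-neg l i (mirror y) c′))
        where
        gap : ∀ y → - (- y - + 1) ≡ y + + 1
        gap = solve-∀
      ¬c₁′ : ¬ Cond l i (mirror y + + 1)
      ¬c₁′ c₁′ = ¬c (subst (Cond l i) (gap y) (Cond-neg l i (mirror y + + 1) c₁′))
        where
        gap : ∀ y → - ((- y - + 1) + + 1) ≡ y
        gap = solve-∀

    private
      down-pred : ∀ y e → (y - + 1) - e ≡ (y - e) - + 1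
      down-pred = solve-∀
      down-suc : ∀ y e → (y + + 1) - e ≡ (y - e) + + 1
      down-suc = solve-∀

    sOp-preserves-DownClosed : DownClosed l S → DownClosed l (sOp l i S)
    sOp-preserves-DownClosed dc y (inj₁ (c , s)) =
      inj₁ (to (Cond-down l i y) c , subst S (down-pred y (period l)) (dc _ s))
    sOp-preserves-DownClosed dc y (inj₂ (inj₁ (¬c , c₁ , s))) =
      inj₂ (inj₁ ( ¬c ∘ from (Cond-down l i y)
                 , subst (Cond l i) (down-suc y (period l)) (to (Cond-down l i (y + + 1)) c₁)
                 , subst S (down-suc y (period l)) (dc _ s)))
    sOp-preserves-DownClosed dc y (inj₂ (inj₂ (¬c , ¬c₁ , s))) =
      inj₂ (inj₂ ( ¬c ∘ from (Cond-down l i y)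
                 , ¬c₁ ∘ from (Cond-down l i (y + + 1)) ∘ subst (Cond l i) (sym (down-suc y (period l)))
                 , dc _ s))


  module _ (l i : ℕ) where

    sOp-cong : ∀ {S T} → S ≐ T → sOp l i S ≐ sOp l i T
    sOp-cong S≐T y = mk⇔ (transport (to ∘ S≐T)) (transport (from ∘ S≐T))
      where
      transport : ∀ {S T : Subset} → (∀ x → S x → T x) → sOp l i S y → sOp l i T y
      transport f = Sum.map (Product.map₂ (f _))
                            (Sum.map (Product.map₂ (Product.map₂ (f _))) (Product.map₂ (Product.map₂ (f _))))

    sOp-involutive : ∀ S → sOp l i (sOp l i S) ≐ S
    sOp-involutive S y with Cond? l i y | Cond? l i (y + + 1)
    ... | yes c | _ = begin
      sOp l i (sOp l i S) y  ≈⟨ sOp-upper l i (sOp l i S) y c ⟩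
      sOp l i S (y - + 1)    ≈⟨ sOp-lower l i S (y - + 1) ¬c′ c′ ⟩
      S ((y - + 1) + + 1)    ≡⟨ cong S (gap y) ⟩
      S y                    ∎
      where
      open ⇔-Reasoning
      gap : ∀ y → (y - + 1) + + 1 ≡ y
      gap = solve-∀
      c′ : Cond l i ((y - + 1) + + 1)
      c′ = subst (Cond l i) (sym (gap y)) c
      ¬c′ : ¬ Cond l i (y - + 1)
      ¬c′ c″ = Cond-not-adjacent l i (y - + 1) c″ c′
    ... | no ¬c | yes c₁ = begin
      sOp l i (sOp l i S) y  ≈⟨ sOp-lower l i (sOp l i S) y ¬c c₁ ⟩
      sOp l i S (y + + 1)    ≈⟨ sOp-upper l i S (y + + 1) c₁ ⟩
      S ((y + + 1) - + 1)    ≡⟨ cong S (gap y) ⟩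
      S y                    ∎
      where
      open ⇔-Reasoning
      gap : ∀ y → (y + + 1) - + 1 ≡ y
      gap = solve-∀
    ... | no ¬c | no ¬c₁ = ⇔-trans (sOp-fixed l i (sOp l i S) y ¬c ¬c₁) (sOp-fixed l i S y ¬c ¬c₁)

  applyWord-preserves : ∀ l (P : Subset → Set) → (∀ i S → P S → P (sOp l i S)) →
                        ∀ w S → P S → P (applyWord l w S)
  applyWord-preserves l P step []      S pS = pS
  applyWord-preserves l P step (i ∷ w) S pS = step (toℕ i) _ (applyWord-preserves l P step w S pS)

  negatives-SelfDual : SelfDual negatives
  negatives-SelfDual x = mk⇔ (λ x<0 mx<0 → absurd-by-gap (i<j⇒suc[i]≤j x<0 ⊕ i<j⇒suc[i]≤j mx<0) (gap₁ x))
                             (λ mx≮0 → suc[i]≤j⇒i<j (≤-by-gap (ℤP.≮⇒≥ mx≮0) (gap₂ x)))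
    where
    gap₁ : ∀ x → 0ℤ - + 1 ≡ (0ℤ + 0ℤ) - ((1ℤ + x) + (1ℤ + (- x - + 1)))
    gap₁ = solve-∀
    gap₂ : ∀ x → 0ℤ - (1ℤ + x) ≡ (- x - + 1) - 0ℤ
    gap₂ = solve-∀

  negatives-DownClosed : ∀ l → DownClosed l negatives
  negatives-DownClosed l x x<0 = suc[i]≤j⇒i<j (≤-by-gap (i<j⇒suc[i]≤j x<0 ⊕ 0≤+ (2 ℕ.* l)) (gap x (period l)))
    where
    gap : ∀ x e → 0ℤ - (1ℤ + (x - e)) ≡ (0ℤ + e) - ((1ℤ + x) + 0ℤ)
    gap = solve-∀

  DownClosed-iterate : ∀ {l S} → DownClosed l S → ∀ m x → S x → S (x - + m * period l)
  DownClosed-iterate {l} {S} dc zero    x s = subst S (gap x (period l)) s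
    where
    gap : ∀ x e → x ≡ x - 0ℤ * e
    gap = solve-∀
  DownClosed-iterate {l} {S} dc (suc m) x s = subst S (gap x (+ m) (period l)) (dc _ (DownClosed-iterate {l} dc m x s))
    where
    gap : ∀ x m e → (x - m * e) - e ≡ x - (1ℤ + m) * e
    gap = solve-∀

  DownClosed-resp-≐ : ∀ {l S T} → S ≐ T → DownClosed l S → DownClosed l T
  DownClosed-resp-≐ S≐T dc x t = to (S≐T _) (dc x (from (S≐T x) t))

  -- Self-conjugacy and 2l-cores on the abacus

  conjBead : Partition → ℕ → ℤ
  conjBead p j = + conjPart p j - + j

  mirror-hole : ∀ p j → mirror (hole p j) ≡ conjBead p j
  mirror-hole p j = gap (+ j) (+ conjPart p j)
    where
    gap : ∀ j k → - (j - + 1 - k) - + 1 ≡ k - j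
    gap = solve-∀

  mirror-conjBead : ∀ p j → mirror (conjBead p j) ≡ hole p j
  mirror-conjBead p j = trans (sym (cong mirror (mirror-hole p j))) (mirror-involutive (hole p j))

  module _ (p : Partition) where

    bead-strictly-decreasing : StrictlyDecreasing (bead p)
    bead-strictly-decreasing = antitone⇒shifted-strictly-decreasing (part p) (part-antitone p)

    conjBead-strictly-decreasing : StrictlyDecreasing (conjBead p)
    conjBead-strictly-decreasing = antitone⇒shifted-strictly-decreasing (conjPart p) (conjPart-antitone p)

    mirror-∉beta0⇒conjBead : ∀ x → ¬ beta0 p (mirror x) → ∃[ j ] (1 ℕ.≤ j × x ≡ conjBead p j)
    mirror-∉beta0⇒conjBead x mx∉β = mirrored (∉beta0⇒hole p (mirror x) mx∉β)
      where
      mirrored : ∃[ j ] (1 ℕ.≤ j × mirror x ≡ hole p j) → ∃[ j ] (1 ℕ.≤ j × x ≡ conjBead p j)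
      mirrored (j , 1≤j , mx≡hole) =
        j , 1≤j , trans (sym (mirror-involutive x)) (trans (cong mirror mx≡hole) (mirror-hole p j))

    SelfDual⇒SelfConjugate : SelfDual (beta0 p) → SelfConjugate p
    SelfDual⇒SelfConjugate sd j 1≤j = ℤP.+-injective (begin
      + part p j                  ≡⟨ gap (+ part p j) (+ j) ⟩
      bead p j + + j              ≡⟨ cong (_+ + j) (strictly-decreasing-same-values⇒≡
                                       bead-strictly-decreasing conjBead-strictly-decreasing
                                       beads-are-conjBeads conjBeads-are-beads j 1≤j) ⟩
      conjBead p j + + j          ≡⟨ gap (+ conjPart p j) (+ j) ⟨
      + conjPart p j              ∎)
      where
      open ≡-Reasoning
      gap : ∀ x j → x ≡ (x - j) + j
      gap = solve-∀
      beads-are-conjBeads : ValuesAmong (bead p) (conjBead p)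
      beads-are-conjBeads i 1≤i = mirror-∉beta0⇒conjBead (bead p i) (to (sd (bead p i)) (i , 1≤i , refl))
      conjBeads-are-beads : ValuesAmong (conjBead p) (bead p)
      conjBeads-are-beads i 1≤i = from (sd (conjBead p i)) λ β∋ →
        hole-∉-beta0 p i 1≤i (subst (beta0 p) (mirror-conjBead p i) β∋)

    SelfConjugate⇒SelfDual : SelfConjugate p → SelfDual (beta0 p)
    SelfConjugate⇒SelfDual sc x = mk⇔ bead⇒mirror∉ mirror∉⇒bead
      where
      bead-is-conjBead : ∀ i → 1 ℕ.≤ i → bead p i ≡ conjBead p i
      bead-is-conjBead i 1≤i = cong (λ v → + v - + i) (sc i 1≤i)
      bead⇒mirror∉ : beta0 p x → ¬ beta0 p (mirror x)
      bead⇒mirror∉ (i , 1≤i , x≡bead) = hole-∉-beta0 p i 1≤i ∘′ subst (beta0 p) mx≡hole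
        where
        mx≡hole : mirror x ≡ hole p i
        mx≡hole = trans (cong mirror (trans x≡bead (bead-is-conjBead i 1≤i)))
                        (mirror-conjBead p i)
      mirror∉⇒bead : ¬ beta0 p (mirror x) → beta0 p x
      mirror∉⇒bead mx∉β =
        let j , 1≤j , x≡conjBead = mirror-∉beta0⇒conjBead x mx∉β
        in  j , 1≤j , trans x≡conjBead (sym (bead-is-conjBead j 1≤j))

    SelfDual⇔SelfConjugate : SelfDual (beta0 p) ⇔ SelfConjugate p
    SelfDual⇔SelfConjugate = mk⇔ SelfDual⇒SelfConjugate SelfConjugate⇒SelfDual

  module _ (l : ℕ) (p : Partition) where

    DownClosed⇒IsCore : DownClosed l (beta0 p) → IsCore (2 ℕ.* l) p
    DownClosed⇒IsCore dc i j 1≤i 1≤j j≤λi (ℕD.divides q hook≡q*2l) =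
      hole-∉-beta0 p j 1≤j (subst (beta0 p) bead-q*2l≡hole (DownClosed-iterate {l} dc q (bead p i) (i , 1≤i , refl)))
      where
      +hook≡q*2l : + hook p i j ≡ + q * period l
      +hook≡q*2l = trans (cong +_ hook≡q*2l) (ℤP.pos-* q (2 ℕ.* l))
      bead-q*2l≡hole : bead p i - + q * period l ≡ hole p j
      bead-q*2l≡hole = trans (cong (λ v → bead p i - v) (trans (sym +hook≡q*2l)
                                                       (hook≡bead-hole p i j j≤λi (≤part⇒≤conjPart p i j 1≤i 1≤j j≤λi))))
                             (gap (bead p i) (hole p j))
        where
        gap : ∀ b h → b - (b - h) ≡ h
        gap = solve-∀

    IsCore⇒DownClosed : IsCore (2 ℕ.* l) p → DownClosed l (beta0 p)
    IsCore⇒DownClosed core x (i , 1≤i , x≡bead) =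
      decidable-stable (beta0? p (x - period l)) λ x-2l∉β → no-2l-hook (∉beta0⇒hole p (x - period l) x-2l∉β)
      where
      no-2l-hook : ¬ (∃[ j ] (1 ℕ.≤ j × x - period l ≡ hole p j))
      no-2l-hook (j , 1≤j , x-2l≡hole) = core i j 1≤i 1≤j j≤λi (ℕD.divides 1 hook≡1*2l)
        where
        bead-hole≡2l : bead p i - hole p j ≡ period l
        bead-hole≡2l = trans (cong₂ _-_ (sym x≡bead) (sym x-2l≡hole)) (gap x (period l))
          where
          gap : ∀ x e → x - (x - e) ≡ e
          gap = solve-∀
        hole≤bead : hole p j ≤ bead p i
        hole≤bead = ≤-by-gap (0≤+ (2 ℕ.* l)) (trans bead-hole≡2l (sym (ℤP.+-identityʳ (period l))))
        i≤λ′j = hole≤bead⇒≤conjPart p i j 1≤i 1≤j hole≤bead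
        j≤λi = ≤conjPart⇒≤part p i j 1≤i i≤λ′j
        +hook≡2l : + hook p i j ≡ period l
        +hook≡2l = trans (hook≡bead-hole p i j j≤λi i≤λ′j) bead-hole≡2l
        hook≡1*2l : hook p i j ≡ 1 ℕ.* (2 ℕ.* l)
        hook≡1*2l = trans (ℤP.+-injective +hook≡2l) (sym (ℕP.*-identityˡ (2 ℕ.* l)))

    DownClosed⇔IsCore : DownClosed l (beta0 p) ⇔ IsCore (2 ℕ.* l) p
    DownClosed⇔IsCore = mk⇔ DownClosed⇒IsCore IsCore⇒DownClosed

  -- Runner heights

  module Runners (k : ℕ) where

    l : ℕ
    l = suc k

    e : ℕ
    e = 2 ℕ.* l

    E : ℤ
    E = period l

    record OnRunner (z : ℤ) (r : ℕ) (q : ℤ) : Set where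
      constructor onRunner
      field
        r<e      : r ℕ.< e
        position : z ≡ + r + q * E

    rem : ℤ → ℕ
    rem z = z %ℕ e

    quo : ℤ → ℤ
    quo z = z /ℕ e

    onRunner-rem-quo : ∀ z → OnRunner z (rem z) (quo z)
    onRunner-rem-quo z = onRunner (n%ℕd<d z e) (a≡a%ℕn+[a/ℕn]*n z e)

    private
      level-below : ∀ {r r′ q q′} → r ℕ.< e → + r + q * E ≡ + r′ + q′ * E → ¬ (q < q′)
      level-below {r} {r′} {q} {q′} r<e eq q<q′ =
        absurd-by-gap (ℤP.*-monoʳ-≤-nonNeg E (i<j⇒suc[i]≤j q<q′) ⊕ i<j⇒suc[i]≤j (+<+ r<e)
                       ⊕ 0≤+ r′ ⊕ ℤP.≤-reflexive (sym eq))
                      (gap (+ r) (+ r′) q q′ E)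
        where
        gap : ∀ r r′ q q′ E → 0ℤ - + 1 ≡ (q′ * E + E + r′ + (r + q * E))
                                          - ((1ℤ + q) * E + (1ℤ + r) + 0ℤ + (r′ + q′ * E))
        gap = solve-∀

    OnRunner-unique : ∀ {z r q r′ q′} → OnRunner z r q → OnRunner z r′ q′ → r ≡ r′ × q ≡ q′
    OnRunner-unique {z} {r} {q} {r′} {q′} (onRunner r<e z≡) (onRunner r′<e z≡′) = r≡r′ , q≡q′
      where
      same : + r + q * E ≡ + r′ + q′ * E
      same = trans (sym z≡) z≡′
      q≡q′ : q ≡ q′
      q≡q′ with ℤP.<-cmp q q′
      ... | tri< q<q′ _ _ = ⊥-elim (level-below r<e same q<q′)
      ... | tri≈ _ q≡q′ _ = q≡q′
      ... | tri> _ _ q′<q = ⊥-elim (level-below r′<e (sym same) q′<q)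
      r≡r′ : r ≡ r′
      r≡r′ = ℤP.+-injective (begin
        + r                     ≡⟨ gap (+ r) q E ⟩
        (+ r + q * E) - q * E   ≡⟨ cong₂ (λ u v → u - v * E) same q≡q′ ⟩
        (+ r′ + q′ * E) - q′ * E ≡⟨ gap (+ r′) q′ E ⟨
        + r′                    ∎)
        where
        open ≡-Reasoning
        gap : ∀ r q E → r ≡ (r + q * E) - q * E
        gap = solve-∀

    Abacus : (ℕ → ℤ) → Subset
    Abacus A z = quo z < A (rem z)

    Abacus-on-runner : ∀ A {z r q} → OnRunner z r q → Abacus A z ⇔ (q < A r)
    Abacus-on-runner A {z} on =
      let r≡ , q≡ = OnRunner-unique (onRunner-rem-quo z) on
      in  subst₂ (λ r q → Abacus A z ⇔ (q < A r)) r≡ q≡ ⇔-refl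

    last : ℕ
    last = ℕ.pred e

    prevHeights : (ℕ → ℤ) → ℕ → ℤ
    prevHeights A zero    = A last + 1ℤ
    prevHeights A (suc r) = A r

    nextHeightsBy : (ℕ → ℤ) → ∀ r → Dec (suc r ≡ e) → ℤ
    nextHeightsBy A r (yes _) = A 0 - 1ℤ
    nextHeightsBy A r (no _)  = A (suc r)

    nextHeights : (ℕ → ℤ) → ℕ → ℤ
    nextHeights A r = nextHeightsBy A r (suc r ℕ.≟ e)

    Abacus-pred-on : ∀ A {z r q} → OnRunner z r q → Abacus A (z - + 1) ⇔ (q < prevHeights A r)
    Abacus-pred-on A {z} {zero} {q} (onRunner _ z≡) =
      ⇔-trans (Abacus-on-runner A (onRunner (ℕP.n<1+n last) (trans (cong (_- + 1) z≡) (gap q (+ last)))))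
              (<-by-gap⇔ (gap′ q (A last)))
      where
      gap : ∀ q m → (+ 0 + q * (1ℤ + m)) - + 1 ≡ m + (q - 1ℤ) * (1ℤ + m)
      gap = solve-∀
      gap′ : ∀ q a → a - (q - 1ℤ) ≡ (a + 1ℤ) - q
      gap′ = solve-∀
    Abacus-pred-on A {z} {suc r} {q} (onRunner r+1<e z≡) =
      Abacus-on-runner A (onRunner (ℕP.<-trans (ℕP.n<1+n r) r+1<e) (trans (cong (_- + 1) z≡) (gap (+ r) q E)))
      where
      gap : ∀ r q E → ((1ℤ + r) + q * E) - + 1 ≡ r + q * E
      gap = solve-∀

    suc-position : ∀ {z r q} → OnRunner z r q → z + + 1 ≡ + suc r + q * E
    suc-position {z} {r} {q} (onRunner _ z≡) = trans (cong (_+ + 1) z≡) (gap (+ r) q E)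
      where
      gap : ∀ r q E → (r + q * E) + + 1 ≡ (1ℤ + r) + q * E
      gap = solve-∀

    Abacus-suc-on : ∀ A {z r q} → OnRunner z r q → (wraps : Dec (suc r ≡ e)) →
                    Abacus A (z + + 1) ⇔ (q < nextHeightsBy A r wraps)
    Abacus-suc-on A {z} {r} {q} on (yes r+1≡e) =
      ⇔-trans (Abacus-on-runner A (onRunner (s≤s z≤n) z+1≡)) (<-by-gap⇔ (gap′ q (A 0)))
      where
      gap : ∀ q E → E + q * E ≡ + 0 + (q + 1ℤ) * E
      gap = solve-∀
      gap′ : ∀ q a → a - (q + 1ℤ) ≡ (a - 1ℤ) - q
      gap′ = solve-∀
      z+1≡ : z + + 1 ≡ + 0 + (q + 1ℤ) * E
      z+1≡ = trans (suc-position on) (trans (cong (λ v → + v + q * E) r+1≡e) (gap q E))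
    Abacus-suc-on A on@(onRunner r<e _) (no r+1≢e) =
      Abacus-on-runner A (onRunner (ℕP.≤∧≢⇒< r<e r+1≢e) (suc-position on))

    Abacus-pred : ∀ A z → Abacus A (z - + 1) ⇔ Abacus (prevHeights A) z
    Abacus-pred A z = Abacus-pred-on A (onRunner-rem-quo z)

    Abacus-suc : ∀ A z → Abacus A (z + + 1) ⇔ Abacus (nextHeights A) z
    Abacus-suc A z = Abacus-suc-on A (onRunner-rem-quo z) (suc (rem z) ℕ.≟ e)

    -- When s_i swaps runner r with runner r - 1 or r + 1, runner r of s_i S carries the
    -- beads of that runner (shifted by a level across runner 0); whether and with which
    -- neighbour it is swapped depends only on r because Cond is periodic.
    τ : ℕ → (ℕ → ℤ) → ℕ → ℤ
    τ i A r = select (Cond? l i (+ r)) (Cond? l i (+ suc r)) (prevHeights A r) (nextHeights A r) (A r)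

    τ-upper : ∀ i A r → Cond l i (+ r) → τ i A r ≡ prevHeights A r
    τ-upper i A r = select-yes (Cond? l i (+ r)) (Cond? l i (+ suc r))

    τ-lower : ∀ i A r → ¬ Cond l i (+ r) → Cond l i (+ suc r) → τ i A r ≡ nextHeights A r
    τ-lower i A r = select-no-yes (Cond? l i (+ r)) (Cond? l i (+ suc r))

    τ-fixed : ∀ i A r → ¬ Cond l i (+ r) → ¬ Cond l i (+ suc r) → τ i A r ≡ A r
    τ-fixed i A r = select-no-no (Cond? l i (+ r)) (Cond? l i (+ suc r))

    Cond-on-runner : ∀ i z → Cond l i z ⇔ Cond l i (+ rem z)
    Cond-on-runner i z = Cond-mod-period l i (+ rem z) (quo z) (OnRunner.position (onRunner-rem-quo z))

    Cond-suc-on-runner : ∀ i z → Cond l i (z + + 1) ⇔ Cond l i (+ suc (rem z))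
    Cond-suc-on-runner i z = Cond-mod-period l i (+ suc (rem z)) (quo z) (suc-position (onRunner-rem-quo z))

    sOp-Abacus : ∀ i A → sOp l i (Abacus A) ≐ Abacus (τ i A)
    sOp-Abacus i A z with Cond? l i z | Cond? l i (z + + 1)
    ... | yes c | _ = begin
      sOp l i (Abacus A) z           ≈⟨ sOp-upper l i (Abacus A) z c ⟩
      Abacus A (z - + 1)             ≈⟨ Abacus-pred A z ⟩
      quo z < prevHeights A (rem z)  ≡⟨ cong (quo z <_) (τ-upper i A (rem z) (to (Cond-on-runner i z) c)) ⟨
      Abacus (τ i A) z               ∎
      where
      open ⇔-Reasoning
    ... | no ¬c | yes c₁ = begin
      sOp l i (Abacus A) z           ≈⟨ sOp-lower l i (Abacus A) z ¬c c₁ ⟩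
      Abacus A (z + + 1)             ≈⟨ Abacus-suc A z ⟩
      quo z < nextHeights A (rem z)  ≡⟨ cong (quo z <_) (τ-lower i A (rem z) (¬c ∘′ from (Cond-on-runner i z))
                                                                             (to (Cond-suc-on-runner i z) c₁)) ⟨
      Abacus (τ i A) z               ∎
      where
      open ⇔-Reasoning
    ... | no ¬c | no ¬c₁ = begin
      sOp l i (Abacus A) z           ≈⟨ sOp-fixed l i (Abacus A) z ¬c ¬c₁ ⟩
      quo z < A (rem z)              ≡⟨ cong (quo z <_) (τ-fixed i A (rem z) (¬c ∘′ from (Cond-on-runner i z))
                                                                             (¬c₁ ∘′ from (Cond-suc-on-runner i z))) ⟨
      Abacus (τ i A) z               ∎
      where
      open ⇔-Reasoning

    e≡l+l : e ≡ l ℕ.+ l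
    e≡l+l = cong (l ℕ.+_) (ℕP.+-identityʳ l)

    Cond-low : ∀ {i r} → i ℕ.≤ l → r ℕ.≤ l → Cond l i (+ r) → r ≡ i
    Cond-low {i} {r} i≤l r≤l (inj₁ 2l∣r-i) =
      ℤP.+-injective (ℤP.i-j≡0⇒i≡j (+ r) (+ i) (ℤP.∣i∣≡0⇒i≡0 (∣-below⇒≡0 2l∣r-i ∣r-i∣<2l)))
      where
      open ℕP.≤-Reasoning
      ∣r-i∣<2l : ℤ.∣ + r - + i ∣ ℕ.< e
      ∣r-i∣<2l = begin-strict
        ℤ.∣ + r - + i ∣  ≡⟨ cong ℤ.∣_∣ (ℤP.m-n≡m⊖n r i) ⟩
        ℤ.∣ r ℤ.⊖ i ∣    ≤⟨ ℤP.∣m⊝n∣≤m⊔n r i ⟩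
        r ℕ.⊔ i          ≤⟨ ℕP.⊔-lub r≤l i≤l ⟩
        l                <⟨ ℕP.m<m+n l (s≤s z≤n) ⟩
        l ℕ.+ l          ≡⟨ e≡l+l ⟨
        e                ∎
    Cond-low {i} {r} i≤l r≤l (inj₂ 2l∣r+i) with r ℕ.+ i ℕ.<? e
    ... | yes r+i<2l = trans (ℕP.m+n≡0⇒m≡0 r r+i≡0) (sym (ℕP.m+n≡0⇒n≡0 r r+i≡0))
      where
      r+i≡0 : r ℕ.+ i ≡ 0
      r+i≡0 = ∣-below⇒≡0 2l∣r+i r+i<2l
    ... | no r+i≮2l = trans (≡l r≤l λ r<l → ℕP.+-mono-<-≤ r<l i≤l)
                            (sym (≡l i≤l λ i<l → ℕP.+-mono-≤-< r≤l i<l))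
      where
      ≡l : ∀ {m} → m ℕ.≤ l → (m ℕ.< l → r ℕ.+ i ℕ.< l ℕ.+ l) → m ≡ l
      ≡l m≤l small = ℕP.≤-antisym m≤l (ℕP.≮⇒≥ λ m<l → r+i≮2l (subst (r ℕ.+ i ℕ.<_) (sym e≡l+l) (small m<l)))

    nextHeights-inner : ∀ A r → suc r ℕ.< e → nextHeights A r ≡ A (suc r)
    nextHeights-inner A r r+1<e = inner (suc r ℕ.≟ e)
      where
      inner : (wraps : Dec (suc r ≡ e)) → nextHeightsBy A r wraps ≡ A (suc r)
      inner (yes r+1≡e) = ⊥-elim (ℕP.<-irrefl r+1≡e r+1<e)
      inner (no _)      = refl

    l<e : l ℕ.< e
    l<e = subst (l ℕ.<_) (sym e≡l+l) (ℕP.m<m+n l (s≤s z≤n))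

    τ-at : ∀ i A → τ i A i ≡ prevHeights A i
    τ-at i A = τ-upper i A i (Cond-self l i)

    τ-before : ∀ {i r} A → suc r ≡ i → i ℕ.≤ l → τ i A r ≡ A (suc r)
    τ-before {i} {r} A refl i≤l =
      trans (τ-lower i A r (λ c → ℕP.1+n≢n (sym (Cond-low i≤l (ℕP.<⇒≤ i≤l) c))) (Cond-self l i))
            (nextHeights-inner A r (ℕP.≤-<-trans i≤l l<e))

    τ-away : ∀ {i r} A → r ℕ.< l → i ℕ.≤ l → r ≢ i → suc r ≢ i → τ i A r ≡ A r
    τ-away {i} {r} A r<l i≤l r≢i r+1≢i =
      τ-fixed i A r (r≢i ∘′ Cond-low i≤l (ℕP.<⇒≤ r<l)) (r+1≢i ∘′ Cond-low i≤l r<l)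

    complementary<e : ∀ {r r′} → r ℕ.+ r′ ℕ.+ 1 ≡ e → r ℕ.< e × r′ ℕ.< e
    complementary<e {r} {r′} r+r′+1≡e = below (ℕP.m≤m+n r r′) , below (ℕP.m≤n+m r′ r)
      where
      below : ∀ {m} → m ℕ.≤ r ℕ.+ r′ → m ℕ.< e
      below {m} m≤ = subst (m ℕ.<_) r+r′+1≡e (ℕP.≤-<-trans m≤ (ℕP.m<m+n (r ℕ.+ r′) (s≤s z≤n)))

    mirror-on-runner : ∀ {z r r′ q} → OnRunner z r′ q → r ℕ.+ r′ ℕ.+ 1 ≡ e → OnRunner (mirror z) r (- q - 1ℤ)
    mirror-on-runner {z} {r} {r′} {q} (onRunner _ z≡) r+r′+1≡e = onRunner r<e (begin
      mirror z                                          ≡⟨ cong mirror z≡ ⟩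
      mirror (+ r′ + q * + e)                           ≡⟨ cong (λ v → mirror (+ r′ + q * + v)) (sym r+r′+1≡e) ⟩
      mirror (+ r′ + q * (+ r + + r′ + + 1))            ≡⟨ gap (+ r) (+ r′) q ⟩
      + r + (- q - 1ℤ) * (+ r + + r′ + + 1)             ≡⟨ cong (λ v → + r + (- q - 1ℤ) * + v) r+r′+1≡e ⟩
      + r + (- q - 1ℤ) * E                              ∎)
      where
      open ≡-Reasoning
      r<e : r ℕ.< e
      r<e = proj₁ (complementary<e r+r′+1≡e)
      gap : ∀ r r′ q → - (r′ + q * (r + r′ + + 1)) - + 1 ≡ r + (- q - 1ℤ) * (r + r′ + + 1)
      gap = solve-∀

    SelfDual⇒heights-antisymmetric : ∀ A → SelfDual (Abacus A) → ∀ r r′ → r ℕ.+ r′ ℕ.+ 1 ≡ e → A r′ ≡ - A r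
    SelfDual⇒heights-antisymmetric A sd r r′ r+r′+1≡e = ≡-by-thresholds λ q → begin
      q < A r′                     ≈⟨ Abacus-on-runner A (on q) ⟨
      Abacus A (z q)               ≈⟨ sd (z q) ⟩
      (¬ Abacus A (mirror (z q)))  ≈⟨ ¬-cong-⇔ (Abacus-on-runner A (mirror-on-runner (on q) r+r′+1≡e)) ⟩
      (¬ (- q - 1ℤ < A r))         ≈⟨ ¬[-q-1<a]⇔q<-a ⟩
      q < - A r                    ∎
      where
      open ⇔-Reasoning
      z : ℤ → ℤ
      z q = + r′ + q * E
      on : ∀ q → OnRunner (z q) r′ q
      on q = onRunner (proj₂ (complementary<e r+r′+1≡e)) refl

    k+l+1≡e : k ℕ.+ l ℕ.+ 1 ≡ e
    k+l+1≡e = identity k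
      where
      identity : ∀ k → k ℕ.+ suc k ℕ.+ 1 ≡ 2 ℕ.* suc k
      identity = ℕ-Solver.solve-∀

  -- Descent to ℤ<0

  module Descent (k : ℕ) where

    open Runners k

    level-negative⇔ : ∀ {z r q} → OnRunner z r q → (q < 0ℤ) ⇔ (z < 0ℤ)
    level-negative⇔ {z} {r} {q} (onRunner r<e z≡) = mk⇔
      (λ q<0 → suc[i]≤j⇒i<j (≤-by-gap (i<j⇒suc[i]≤j (+<+ r<e) ⊕ ℤP.*-monoʳ-≤-nonNeg E (i<j⇒suc[i]≤j q<0)
                                       ⊕ ℤP.≤-reflexive z≡)
                                      (gap₁ (+ r) q E z)))
      (λ z<0 → ℤP.≰⇒> λ 0≤q → absurd-by-gap (i<j⇒suc[i]≤j z<0 ⊕ 0≤+ r ⊕ ℤP.*-monoʳ-≤-nonNeg E 0≤q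
                                              ⊕ ℤP.≤-reflexive (sym z≡))
                                             (gap₂ (+ r) q E z))
      where
      gap₁ : ∀ r q E z → 0ℤ - (1ℤ + z) ≡ (E + 0ℤ * E + (r + q * E)) - ((1ℤ + r) + (1ℤ + q) * E + z)
      gap₁ = solve-∀
      gap₂ : ∀ r q E z → 0ℤ - + 1 ≡ (0ℤ + r + q * E + z) - ((1ℤ + z) + 0ℤ + 0ℤ * E + (r + q * E))
      gap₂ = solve-∀

    Abacus-zero : ∀ A → (∀ r → r ℕ.< e → A r ≡ 0ℤ) → Abacus A ≐ negatives
    Abacus-zero A A≡0 z = begin
      Abacus A z  ≡⟨ cong (quo z <_) (A≡0 (rem z) (OnRunner.r<e on)) ⟩
      quo z < 0ℤ  ≈⟨ level-negative⇔ on ⟩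
      z < 0ℤ      ∎
      where
      open ⇔-Reasoning
      on = onRunner-rem-quo z

    -- For self-dual heights, size A = |λ| where β₀(λ) = Abacus A: it is the
    -- Garvan–Kim–Stanton formula Σ_r (l·(A r)² + r·A r) folded along A (2l-1-r) = - A r.
    weight : ℕ → ℤ → ℤ
    weight r x = x * (E * x + (+ r + + r + 1ℤ) - E)

    size : (ℕ → ℤ) → ℤ
    size A = sumℤ l (λ r → weight r (A r))

    weight-nonneg : ∀ r x → r ℕ.< l → 0ℤ ≤ weight r x
    weight-nonneg r x r<l with ℤP.<-cmp x 0ℤ
    ... | tri< x<0 _ _ = subst (_≤ weight r x) (ℤP.*-zeroʳ x)
                               (ℤP.*-monoˡ-≤-nonPos x {{ℤ.nonPositive (ℤP.<⇒≤ x<0)}} second≤0)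
      where
      second≤0 : E * x + (+ r + + r + 1ℤ) - E ≤ 0ℤ
      second≤0 = ≤-by-gap (ℤP.*-monoʳ-≤-nonNeg E (i<j⇒suc[i]≤j x<0) ⊕ +≤+ r<l ⊕ +≤+ r<l
                           ⊕ ℤP.≤-reflexive (sym (ℤP.pos-* 2 l)) ⊕ 0≤+ (2 ℕ.* l) ⊕ 0≤+ 1)
                          (gap E x (+ r) (+ l))
        where
        gap : ∀ E x r l → 0ℤ - (E * x + (r + r + 1ℤ) - E) ≡
              (0ℤ * E + l + l + E + E + + 1) - ((1ℤ + x) * E + (1ℤ + r) + (1ℤ + r) + + 2 * l + 0ℤ + 0ℤ)
        gap = solve-∀
    ... | tri≈ _ refl _ = ℤP.≤-refl
    ... | tri> _ _ x>0 = subst (_≤ weight r x) (ℤP.*-zeroʳ x)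
                               (ℤP.*-monoˡ-≤-nonNeg x {{ℤ.nonNegative (ℤP.<⇒≤ x>0)}} second≥0)
      where
      second≥0 : 0ℤ ≤ E * x + (+ r + + r + 1ℤ) - E
      second≥0 = ≤-by-gap (ℤP.*-monoʳ-≤-nonNeg E (i<j⇒suc[i]≤j x>0) ⊕ 0≤+ r ⊕ 0≤+ r ⊕ 0≤+ 1) (gap E x (+ r))
        where
        gap : ∀ E x r → (E * x + (r + r + 1ℤ) - E) - 0ℤ ≡ (x * E + r + r + + 1) - ((1ℤ + 0ℤ) * E + 0ℤ + 0ℤ + 0ℤ)
        gap = solve-∀

    size-nonneg : ∀ A → 0ℤ ≤ size A
    size-nonneg A = sumℤ-nonneg l (λ r → weight r (A r)) (λ r → weight-nonneg r (A r))

    private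
      weight-unchanged : ∀ r {x y} → x ≡ y → weight r x - weight r y ≡ 0ℤ
      weight-unchanged r {x} refl = ℤP.+-inverseʳ (weight r x)

    size-change-single : ∀ A A′ j → j ℕ.< l → (∀ r → r ℕ.< l → r ≢ j → A′ r ≡ A r) →
                         size A′ ≡ size A + (weight j (A′ j) - weight j (A j))
    size-change-single A A′ j j<l same =
      trans (sumℤ-change l (λ r → weight r (A r)) (λ r → weight r (A′ r)))
            (cong (λ δ → size A + δ) (sumℤ-single l (λ r → weight r (A′ r) - weight r (A r)) j j<l
                                                  (λ r r<l r≢j → weight-unchanged r (same r r<l r≢j))))

    size-change-adjacent : ∀ A A′ j → suc j ℕ.< l → (∀ r → r ℕ.< l → r ≢ j → r ≢ suc j → A′ r ≡ A r) →
                           size A′ ≡ size A + ((weight j (A′ j) - weight j (A j))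
                                              + (weight (suc j) (A′ (suc j)) - weight (suc j) (A (suc j))))
    size-change-adjacent A A′ j j+1<l same =
      trans (sumℤ-change l (λ r → weight r (A r)) (λ r → weight r (A′ r)))
            (cong (λ δ → size A + δ) (sumℤ-adjacent l (λ r → weight r (A′ r) - weight r (A r)) j j+1<l
                                 (λ r r<l r≢j r≢j+1 → weight-unchanged r (same r r<l r≢j r≢j+1))))

    shrinks-by : ∀ A A′ {δ} → size A′ ≡ size A + δ → δ < 0ℤ → size A′ < size A
    shrinks-by A A′ {δ} eq δ<0 =
      subst (_< size A) (sym eq) (suc[i]≤j⇒i<j (≤-by-gap (i<j⇒suc[i]≤j δ<0) (gap (size A) δ)))
      where
      gap : ∀ s δ → s - (1ℤ + (s + δ)) ≡ 0ℤ - (1ℤ + δ)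
      gap = solve-∀

    τ₀-shrinks : ∀ A → SelfDual (Abacus A) → 1ℤ ≤ A 0 → size (τ 0 A) < size A
    τ₀-shrinks A sd 1≤A0 =
      shrinks-by A (τ 0 A) (trans (size-change-single A (τ 0 A) 0 (s≤s z≤n) unchanged) (cong (λ δ → size A + δ) change))
                 (suc[i]≤j⇒i<j (≤-by-gap (1≤A0 ⊕ 1≤A0) (gap (A 0))))
      where
      unchanged : ∀ r → r ℕ.< l → r ≢ 0 → τ 0 A r ≡ A r
      unchanged zero    _   0≢0 = ⊥-elim (0≢0 refl)
      unchanged (suc r) r<l _   = τ-away A r<l z≤n (λ ()) (λ ())
      Alast≡-A0 : A last ≡ - A 0
      Alast≡-A0 = SelfDual⇒heights-antisymmetric A sd 0 last (ℕP.+-comm last 1)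
      change : weight 0 (τ 0 A 0) - weight 0 (A 0) ≡ 1ℤ - + 2 * A 0
      change = trans (cong (λ h → weight 0 h - weight 0 (A 0)) (trans (τ-at 0 A) (cong (_+ 1ℤ) Alast≡-A0)))
                     (gap′ E (A 0))
        where
        gap′ : ∀ E a → (- a + 1ℤ) * (E * (- a + 1ℤ) + (+ 0 + + 0 + 1ℤ) - E) - a * (E * a + (+ 0 + + 0 + 1ℤ) - E)
                       ≡ 1ℤ - + 2 * a
        gap′ = solve-∀
      gap : ∀ a → 0ℤ - (1ℤ + (1ℤ - + 2 * a)) ≡ (a + a) - (1ℤ + 1ℤ)
      gap = solve-∀

    τ-swap-shrinks : ∀ A j → suc j ℕ.< l → A j < A (suc j) → size (τ (suc j) A) < size A
    τ-swap-shrinks A j j+1<l Aj<Aj+1 =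
      shrinks-by A (τ (suc j) A)
                 (trans (size-change-adjacent A (τ (suc j) A) j j+1<l unchanged) (cong (λ δ → size A + δ) change))
                 (suc[i]≤j⇒i<j (≤-by-gap (i<j⇒suc[i]≤j Aj<Aj+1 ⊕ i<j⇒suc[i]≤j Aj<Aj+1 ⊕ 0≤+ 1) (gap (A j) (A (suc j)))))
      where
      j+1≤l = ℕP.<⇒≤ j+1<l
      unchanged : ∀ r → r ℕ.< l → r ≢ j → r ≢ suc j → τ (suc j) A r ≡ A r
      unchanged r r<l r≢j r≢j+1 = τ-away A r<l j+1≤l r≢j+1 (r≢j ∘′ ℕP.suc-injective)
      change : (weight j (τ (suc j) A j) - weight j (A j))
               + (weight (suc j) (τ (suc j) A (suc j)) - weight (suc j) (A (suc j)))
               ≡ + 2 * (A j - A (suc j))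
      change = trans (cong₂ (λ u v → (weight j u - weight j (A j)) + (weight (suc j) v - weight (suc j) (A (suc j))))
                            (τ-before A refl j+1≤l) (τ-at (suc j) A))
                     (gap′ E (+ j) (A j) (A (suc j)))
        where
        gap′ : ∀ E j x y → (y * (E * y + (j + j + 1ℤ) - E) - x * (E * x + (j + j + 1ℤ) - E))
                           + (x * (E * x + ((1ℤ + j) + (1ℤ + j) + 1ℤ) - E) - y * (E * y + ((1ℤ + j) + (1ℤ + j) + 1ℤ) - E))
                           ≡ + 2 * (x - y)
        gap′ = solve-∀
      gap : ∀ x y → 0ℤ - (1ℤ + + 2 * (x - y)) ≡ (y + y + + 1) - ((1ℤ + x) + (1ℤ + x) + 0ℤ)
      gap = solve-∀

    τₗ-shrinks : ∀ A → SelfDual (Abacus A) → A k < 0ℤ → size (τ l A) < size A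
    τₗ-shrinks A sd Ak<0 =
      shrinks-by A (τ l A) (trans (size-change-single A (τ l A) k (ℕP.n<1+n k) unchanged) (cong (λ δ → size A + δ) change))
                 (suc[i]≤j⇒i<j (≤-by-gap (i<j⇒suc[i]≤j Ak<0 ⊕ i<j⇒suc[i]≤j Ak<0 ⊕ 0≤+ 1) (gap (A k))))
      where
      unchanged : ∀ r → r ℕ.< l → r ≢ k → τ l A r ≡ A r
      unchanged r r<l r≢k = τ-away A r<l ℕP.≤-refl (ℕP.<⇒≢ r<l) (r≢k ∘′ ℕP.suc-injective)
      Al≡-Ak : A l ≡ - A k
      Al≡-Ak = SelfDual⇒heights-antisymmetric A sd k l k+l+1≡e
      change : weight k (τ l A k) - weight k (A k) ≡ + 2 * A k
      change = trans (cong (λ h → weight k h - weight k (A k)) (trans (τ-before A refl ℕP.≤-refl) Al≡-Ak))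
                     (trans (cong change-for-period (ℤP.pos-* 2 l)) (gap′ (A k) (+ k)))
        where
        change-for-period : ℤ → ℤ
        change-for-period E′ = (- A k) * (E′ * (- A k) + (+ k + + k + 1ℤ) - E′)
                               - A k * (E′ * A k + (+ k + + k + 1ℤ) - E′)
        gap′ : ∀ x k → (- x) * (+ 2 * (1ℤ + k) * (- x) + (k + k + 1ℤ) - + 2 * (1ℤ + k))
                       - x * (+ 2 * (1ℤ + k) * x + (k + k + 1ℤ) - + 2 * (1ℤ + k)) ≡ + 2 * x
        gap′ = solve-∀
      gap : ∀ x → 0ℤ - (1ℤ + + 2 * x) ≡ (0ℤ + 0ℤ + + 1) - ((1ℤ + x) + (1ℤ + x) + 0ℤ)
      gap = solve-∀

    module Settled (A : ℕ → ℤ) (sd : SelfDual (Abacus A)) (A0≤0 : A 0 ≤ 0ℤ)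
                   (A↓ : ∀ j → j ℕ.< k → A (suc j) ≤ A j) (0≤Ak : 0ℤ ≤ A k) where

      heights-antitone : ∀ r s → r ℕ.≤ s → s ℕ.≤ k → A s ≤ A r
      heights-antitone r zero    r≤0     _      = ℤP.≤-reflexive (cong A (sym (ℕP.n≤0⇒n≡0 r≤0)))
      heights-antitone r (suc s) r≤s+1 s+1≤k with r ℕ.≟ suc s
      ... | yes refl   = ℤP.≤-refl
      ... | no r≢s+1 = ℤP.≤-trans (A↓ s s+1≤k)
                                  (heights-antitone r s (ℕP.≤-pred (ℕP.≤∧≢⇒< r≤s+1 r≢s+1)) (ℕP.<⇒≤ s+1≤k))

      low-heights-zero : ∀ r → r ℕ.≤ k → A r ≡ 0ℤ
      low-heights-zero r r≤k = ℤP.≤-antisym (ℤP.≤-trans (heights-antitone 0 r z≤n r≤k) A0≤0)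
                                            (ℤP.≤-trans 0≤Ak (heights-antitone r k r≤k ℕP.≤-refl))

      heights-zero : ∀ r → r ℕ.< e → A r ≡ 0ℤ
      heights-zero r r<e with r ℕ.<? l
      ... | yes r<l = low-heights-zero r (ℕP.≤-pred r<l)
      ... | no r≮l = trans (SelfDual⇒heights-antisymmetric A sd (k ℕ.∸ t) r r′+r+1≡e)
                           (cong -_ (low-heights-zero (k ℕ.∸ t) (ℕP.m∸n≤m k t)))
        where
        t = r ℕ.∸ l
        l+t≡r : l ℕ.+ t ≡ r
        l+t≡r = ℕP.m+[n∸m]≡n (ℕP.≮⇒≥ r≮l)
        t≤k : t ℕ.≤ k
        t≤k = ℕP.≤-pred (ℕP.+-cancelˡ-< l t l (subst₂ ℕ._<_ (sym l+t≡r) e≡l+l r<e))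
        r′+r+1≡e : k ℕ.∸ t ℕ.+ r ℕ.+ 1 ≡ e
        r′+r+1≡e = begin
          k ℕ.∸ t ℕ.+ r ℕ.+ 1          ≡⟨ cong (λ v → k ℕ.∸ t ℕ.+ v ℕ.+ 1) (sym l+t≡r) ⟩
          k ℕ.∸ t ℕ.+ (l ℕ.+ t) ℕ.+ 1  ≡⟨ regroup (k ℕ.∸ t) l t ⟩
          k ℕ.∸ t ℕ.+ t ℕ.+ l ℕ.+ 1    ≡⟨ cong (λ v → v ℕ.+ l ℕ.+ 1) (ℕP.m∸n+n≡m t≤k) ⟩
          k ℕ.+ l ℕ.+ 1                ≡⟨ k+l+1≡e ⟩
          e                            ∎
          where
          open ≡-Reasoning
          regroup : ∀ a l t → a ℕ.+ (l ℕ.+ t) ℕ.+ 1 ≡ a ℕ.+ t ℕ.+ l ℕ.+ 1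
          regroup = ℕ-Solver.solve-∀

    Move : (ℕ → ℤ) → Set
    Move A = ∃[ i ] (i ℕ.≤ l × size (τ i A) < size A)

    move-or-settled : ∀ A → SelfDual (Abacus A) → Move A ⊎ (Abacus A ≐ negatives)
    move-or-settled A sd = by-cases (1ℤ ℤP.≤? A 0) (ℕP.anyUpTo? (λ j → A j ℤP.<? A (suc j)) k) (A k ℤP.<? 0ℤ)
      where
      by-cases : Dec (1ℤ ≤ A 0) → Dec (∃[ j ] (j ℕ.< k × A j < A (suc j))) → Dec (A k < 0ℤ) →
                 Move A ⊎ (Abacus A ≐ negatives)
      by-cases (yes 1≤A0) _                        _          = inj₁ (0 , z≤n , τ₀-shrinks A sd 1≤A0)
      by-cases _          (yes (j , j<k , ascent)) _          =
        inj₁ (suc j , s≤s (ℕP.<⇒≤ j<k) , τ-swap-shrinks A j (s≤s j<k) ascent)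
      by-cases _          _                        (yes Ak<0) = inj₁ (l , ℕP.≤-refl , τₗ-shrinks A sd Ak<0)
      by-cases (no 1≰A0)  (no no-ascent)           (no Ak≮0)  =
        inj₂ (Abacus-zero A (Settled.heights-zero A sd A0≤0 (λ j j<k → ℤP.≮⇒≥ λ ascent → no-ascent (j , j<k , ascent))
                                                  (ℤP.≮⇒≥ Ak≮0)))
        where
        A0≤0 : A 0 ≤ 0ℤ
        A0≤0 = ≤-by-gap (i<j⇒suc[i]≤j (ℤP.≰⇒> 1≰A0)) (gap (A 0))
          where
          gap : ∀ a → 0ℤ - a ≡ 1ℤ - (1ℤ + a)
          gap = solve-∀

    W : List (Fin (suc l)) → Subset
    W w = applyWord l w negatives

    τ-preserves-SelfDual : ∀ i A → SelfDual (Abacus A) → SelfDual (Abacus (τ i A))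
    τ-preserves-SelfDual i A sd = SelfDual-resp-≐ (sOp-Abacus i A) (sOp-preserves-SelfDual l i (Abacus A) sd)

    prepend : ∀ i → i ℕ.≤ l → ∀ A → ∃[ w ] (Abacus (τ i A) ≐ W w) → ∃[ w ] (Abacus A ≐ W w)
    prepend i i≤l A (w , τA≐Ww) = fromℕ< (s≤s i≤l) ∷ w , A≐W
      where
      A≐W : Abacus A ≐ W (fromℕ< (s≤s i≤l) ∷ w)
      A≐W rewrite FinP.toℕ-fromℕ< (s≤s i≤l) =
        ≐-trans (≐-sym (sOp-involutive l i (Abacus A))) (sOp-cong l i (≐-trans (sOp-Abacus i A) τA≐Ww))

    reachable-within : ∀ fuel A → ℤ.∣ size A ∣ ℕ.< fuel → SelfDual (Abacus A) → ∃[ w ] (Abacus A ≐ W w)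
    reachable-within zero       A ()         sd
    reachable-within (suc fuel) A size<fuel+1 sd = continue (move-or-settled A sd)
      where
      continue : Move A ⊎ (Abacus A ≐ negatives) → ∃[ w ] (Abacus A ≐ W w)
      continue (inj₂ settled)              = [] , settled
      continue (inj₁ (i , i≤l , shrinks)) =
        prepend i i≤l A (reachable-within fuel (τ i A)
                           (ℕP.<-≤-trans (∣∣-mono-< (size-nonneg (τ i A)) shrinks) (ℕP.≤-pred size<fuel+1))
                           (τ-preserves-SelfDual i A sd))

    reachable : ∀ A → SelfDual (Abacus A) → ∃[ w ] (Abacus A ≐ W w)
    reachable A = reachable-within (suc ℤ.∣ size A ∣) A (ℕP.n<1+n _)

  -- The runner heights of a down-closed set

  module Heights (k : ℕ) (S : Subset) (S? : ∀ z → Dec (S z)) (dc : DownClosed (suc k) S) (B : ℕ)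
                 (bottom : ∀ z → z + + B < 0ℤ → S z) (top : ∀ z → + B ≤ z → ¬ S z) where

    open Runners k

    depth : ℕ
    depth = suc B

    level : ℕ → ℕ → ℤ
    level r n = + r + (+ n - + depth) * E

    level-bottom : ∀ r → r ℕ.< e → S (level r 0)
    level-bottom r r<e = bottom (level r 0)
      (suc[i]≤j⇒i<j (≤-by-gap (ℤP.*-monoˡ-≤-nonNeg (+ B) (+≤+ (s≤s z≤n)) ⊕ i<j⇒suc[i]≤j (+<+ r<e))
                              (gap (+ r) (+ B) E)))
      where
      gap : ∀ r b E → 0ℤ - (1ℤ + (r + (+ 0 - (1ℤ + b)) * E + b)) ≡ (b * E + E) - (b * 1ℤ + (1ℤ + r))
      gap = solve-∀

    level-top : ∀ r → ¬ S (level r (depth ℕ.+ depth))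
    level-top r = top (level r (depth ℕ.+ depth))
      (≤-by-gap (ℤP.*-monoˡ-≤-nonNeg (+ depth) (+≤+ (s≤s z≤n)) ⊕ 0≤+ r ⊕ 0≤+ 1) (gap (+ r) (+ B) E))
      where
      gap : ∀ r b E → (r + (((1ℤ + b) + (1ℤ + b)) - (1ℤ + b)) * E) - b
                      ≡ ((1ℤ + b) * E + r + + 1) - ((1ℤ + b) * 1ℤ + 0ℤ + 0ℤ)
      gap = solve-∀

    level-step : ∀ r n → S (level r (suc n)) → S (level r n)
    level-step r n s = subst S (gap (+ r) (+ n) (+ depth) E) (dc _ s)
      where
      gap : ∀ r n d E → r + ((1ℤ + n) - d) * E - E ≡ r + (n - d) * E
      gap = solve-∀

    filled : ℕ → ℕ
    filled r = run-length (λ n → S? (level r n)) (depth ℕ.+ depth)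

    heights : ℕ → ℤ
    heights r = + filled r - + depth

    heights-spec : ∀ {z r q} → OnRunner z r q → S z ⇔ (q < heights r)
    heights-spec {z} {r} {q} (onRunner r<e z≡) with q + + depth ℤP.<? 0ℤ
    ... | yes deep = mk⇔ (λ _ → q<heights) (λ _ → S-deep)
      where
      m : ℕ
      m = ℤ.∣ - (q + + depth) ∣
      +m≡ : + m ≡ - (q + + depth)
      +m≡ = ℤP.0≤i⇒+∣i∣≡i (≤-by-gap (i<j⇒suc[i]≤j deep ⊕ 0≤+ 1) (gap₀ q (+ depth)))
        where
        gap₀ : ∀ q d → - (q + d) - 0ℤ ≡ (0ℤ + + 1) - ((1ℤ + (q + d)) + 0ℤ)
        gap₀ = solve-∀
      S-deep : S z
      S-deep = subst S (trans (cong (λ v → level r 0 - v * E) +m≡) (trans (gap₁ (+ r) q (+ depth) E) (sym z≡)))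
                       (DownClosed-iterate {l} dc m (level r 0) (level-bottom r r<e))
        where
        gap₁ : ∀ r q d E → (r + (+ 0 - d) * E) - (- (q + d)) * E ≡ r + q * E
        gap₁ = solve-∀
      q<heights : q < heights r
      q<heights = suc[i]≤j⇒i<j (≤-by-gap (i<j⇒suc[i]≤j deep ⊕ 0≤+ (filled r)) (gap₂ q (+ depth) (+ filled r)))
        where
        gap₂ : ∀ q d L → (L - d) - (1ℤ + q) ≡ (0ℤ + L) - (1ℤ + (q + d) + 0ℤ)
        gap₂ = solve-∀
    ... | no shallow = begin
      S z                        ≡⟨ cong S (trans z≡ (cong (λ v → + r + v * E) q≡)) ⟩
      S (level r n)              ≈⟨ run-length-spec (λ n → S? (level r n)) (level-step r)
                                                    (depth ℕ.+ depth) (level-top r) n ⟩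
      n ℕ.< filled r             ≈⟨ mk⇔ +<+ ℤP.drop‿+<+ ⟩
      + n < + filled r           ≈⟨ <-by-gap⇔ (gap′ (+ n) (+ filled r) (+ depth)) ⟩
      + n - + depth < heights r  ≡⟨ cong (_< heights r) (sym q≡) ⟩
      q < heights r              ∎
      where
      open ⇔-Reasoning
      gap′ : ∀ n L d → L - n ≡ (L - d) - (n - d)
      gap′ = solve-∀
      n : ℕ
      n = ℤ.∣ q + + depth ∣
      q≡ : q ≡ + n - + depth
      q≡ = trans (gap q (+ depth)) (cong (_- + depth) (sym (ℤP.0≤i⇒+∣i∣≡i (ℤP.≮⇒≥ shallow))))
        where
        gap : ∀ q d → q ≡ (q + d) - d
        gap = solve-∀

    ≐Abacus-heights : S ≐ Abacus heights
    ≐Abacus-heights z = ⇔-trans (heights-spec on) (⇔-sym (Abacus-on-runner heights on))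
      where
      on = onRunner-rem-quo z

  module _ (k : ℕ) (p : Partition) where

    open Runners k
    open Descent k

    beta0-as-Abacus : DownClosed l (beta0 p) → ∃[ A ] (beta0 p ≐ Abacus A)
    beta0-as-Abacus dc = heights , ≐Abacus-heights
      where
      open Heights k (beta0 p) (beta0? p) dc (beta0-radius p) (beta0-below-radius p) (beta0-above-radius p)

    reachable⇔SelfDual×DownClosed : (∃[ w ] (beta0 p ≐ W w)) ⇔ (SelfDual (beta0 p) × DownClosed l (beta0 p))
    reachable⇔SelfDual×DownClosed = mk⇔ invariants reach
      where
      invariants : ∃[ w ] (beta0 p ≐ W w) → SelfDual (beta0 p) × DownClosed l (beta0 p)
      invariants (w , β≐W) =
          SelfDual-resp-≐ (≐-sym β≐W)
            (applyWord-preserves l SelfDual (sOp-preserves-SelfDual l) w negatives negatives-SelfDual)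
        , DownClosed-resp-≐ {l} (≐-sym β≐W)
            (applyWord-preserves l (DownClosed l) (sOp-preserves-DownClosed l) w negatives (negatives-DownClosed l))
      reach : SelfDual (beta0 p) × DownClosed l (beta0 p) → ∃[ w ] (beta0 p ≐ W w)
      reach (sd , dc) =
        let A , β≐A = beta0-as-Abacus dc
            w , A≐W = reachable A (SelfDual-resp-≐ β≐A sd)
        in  w , ≐-trans β≐A A≐W

  IsCAbacusCore⇔reachable : ∀ l p → IsCAbacusCore l p ⇔ (∃[ w ] (beta0 p ≐ applyWord l w negatives))
  IsCAbacusCore⇔reachable l p = mk⇔ (λ (w , β⇄W) → w , λ x → mk⇔ (proj₁ (β⇄W x)) (proj₂ (β⇄W x)))
                                    (λ (w , β≐W) → w , λ x → to (β≐W x) , from (β≐W x))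

  IsCAbacusCore⇔SelfConjugate×IsCore : ∀ k p →
    IsCAbacusCore (suc k) p ⇔ (SelfConjugate p × IsCore (2 ℕ.* suc k) p)
  IsCAbacusCore⇔SelfConjugate×IsCore k p = begin
    IsCAbacusCore (suc k) p                              ≈⟨ IsCAbacusCore⇔reachable (suc k) p ⟩
    (∃[ w ] (beta0 p ≐ applyWord (suc k) w negatives))   ≈⟨ reachable⇔SelfDual×DownClosed k p ⟩
    (SelfDual (beta0 p) × DownClosed (suc k) (beta0 p))  ≈⟨ SelfDual⇔SelfConjugate p ×-⇔ DownClosed⇔IsCore (suc k) p ⟩
    (SelfConjugate p × IsCore (2 ℕ.* suc k) p)           ∎
    where
    open ⇔-Reasoning

open import Data.Nat using (ℕ; zero; suc; _≤_; _*_)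
open import Data.Product using (_×_)
open import Function.Bundles using (_⇔_)
open SelfConjugateCores using (IsCAbacusCore⇔SelfConjugate×IsCore)

lemma3p19 : (l : ℕ) → 2 ≤ l → (p : Partition) →
    IsCAbacusCore l p ⇔ (SelfConjugate p × IsCore (2 * l) p)
lemma3p19 zero    ()
lemma3p19 (suc k) _  p = IsCAbacusCore⇔SelfConjugate×IsCore k p
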